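{- Let $\Phi=\{4321,\,34512,\,45123,\,35412,\,43512,\,45132,\,45213,\,53412,\,45312,\,45231\}$ and let $w\in\mathfrak{S}_N$. If $w$ has no $N$-occurrence of any pattern in $\Phi$, then $|\mathrm{newrep}(w)|=[321;3412]_N(w)$.
   Context: Permutations are written in one-line notation; $s_i$ is the simple reflection interchanging $i$ and $i+1$; $\mathrm{supp}(u)$ is the set of distinct simple reflections appearing in a reduced decomposition of $u$ (independent of the choice). An occurrence of a pattern $p\in\mathfrak{S}_k$ in $w$ is a subsequence $w(i_1)\cdots w(i_k)$, $i_1<\cdots<i_k$, in the same relative order as $p$; it is an $N$-occurrence if its largest value is $N$. $[321;3412]_N(w)$ is the number of $N$-occurrences of $321$ in $w$ plus the number of $N$-occurrences of $3412$ in $w$. For $w\in\mathfrak{S}_N$, $\overline{w}\in\mathfrak{S}_{N-1}$ is obtained by deleting the letter $N$ from the one-line notation of $w$, and $\mathrm{newrep}(w)=\{k:\ s_k\in\mathrm{supp}(\overline{w}),\ w^{ -1}(N)\le k\}$. -}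

module Defs where

open import Data.Nat as ℕ using (ℕ; zero; suc; _≤_)
import Data.Nat.Properties as ℕP
open import Data.Fin as Fin using (Fin; toℕ; fromℕ; inject₁)
open import Data.Fin.Properties as FinP using (all?; any?)
open import Data.Fin.Permutation using (Permutation′; _⟨$⟩ʳ_; _⟨$⟩ˡ_; remove; transpose)
open import Data.Vec as Vec using (Vec; []; _∷_; lookup)
open import Data.List as List using (List; []; _∷_; length; filter; concatMap; allFin)
open import Data.List.Relation.Unary.Any using (Any)
open import Data.Product using (Σ; ∃; _×_; _,_)
open import Data.Empty using (⊥)
open import Function using (_∘_; id)
open import Relation.Binary.PropositionalEquality using (_≡_)
open import Relation.Nullary using (Dec; ¬_)
open import Relation.Nullary.Decidable using (_×-dec_; _→-dec_)

-- A permutation w ∈ 𝔖_N is a stdlib  Permutation′ N  on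
-- Fin N = {0,…,N-1}; the letter/position i (1-based in the paper) is the
-- element i-1 of Fin N.  One-line notation: w(1) … w(N) is
-- (w ⟨$⟩ʳ 0) … (w ⟨$⟩ʳ (N-1)).

allVecs : ∀ {N} k → List (Vec (Fin N) k)
allVecs zero    = [] ∷ []
allVecs (suc k) = concatMap (λ i → List.map (i ∷_) (allVecs k)) (allFin _)

Increasing : ∀ {N k} → Vec (Fin N) k → Set
Increasing {k = k} is = ∀ (a b : Fin k) → a Fin.< b → lookup is a Fin.< lookup is b

-- w(i₁) ⋯ w(i_k) is in the same relative order as the pattern p
-- (p is given in one-line notation with values 1…k)
SameOrder : ∀ {N k} → Vec ℕ k → Permutation′ N → Vec (Fin N) k → Set
SameOrder {k = k} p w is =
  ∀ (a b : Fin k) →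
    (lookup p a ℕ.< lookup p b → (w ⟨$⟩ʳ lookup is a) Fin.< (w ⟨$⟩ʳ lookup is b))
    × ((w ⟨$⟩ʳ lookup is a) Fin.< (w ⟨$⟩ʳ lookup is b) → lookup p a ℕ.< lookup p b)

HasTopValue : ∀ {n k} → Permutation′ (suc n) → Vec (Fin (suc n)) k → Set
HasTopValue {n} {k} w is = ∃ λ (a : Fin k) → w ⟨$⟩ʳ lookup is a ≡ fromℕ n

NOcc : ∀ {n k} → Vec ℕ k → Permutation′ (suc n) → Vec (Fin (suc n)) k → Set
NOcc p w is = Increasing is × SameOrder p w is × HasTopValue w is

NOcc? : ∀ {n k} (p : Vec ℕ k) (w : Permutation′ (suc n)) (is : Vec (Fin (suc n)) k) →
        Dec (NOcc p w is)
NOcc? p w is =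
  all? (λ a → all? (λ b → (a Fin.<? b) →-dec (lookup is a Fin.<? lookup is b)))
  ×-dec
  all? (λ a → all? (λ b →
     ((lookup p a ℕ.<? lookup p b) →-dec ((w ⟨$⟩ʳ lookup is a) Fin.<? (w ⟨$⟩ʳ lookup is b)))
     ×-dec
     (((w ⟨$⟩ʳ lookup is a) Fin.<? (w ⟨$⟩ʳ lookup is b)) →-dec (lookup p a ℕ.<? lookup p b))))
  ×-dec
  any? (λ a → (w ⟨$⟩ʳ lookup is a) Fin.≟ fromℕ _)

countNOcc : ∀ {n k} → Vec ℕ k → Permutation′ (suc n) → ℕ
countNOcc {k = k} p w = length (filter (NOcc? p w) (allVecs k))

AvoidsN : ∀ {n k} → Vec ℕ k → Permutation′ (suc n) → Set
AvoidsN {n} {k} p w = ∀ (is : Vec (Fin (suc n)) k) → ¬ NOcc p w is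

p321 : Vec ℕ 3
p321 = 3 ∷ 2 ∷ 1 ∷ []

p3412 : Vec ℕ 4
p3412 = 3 ∷ 4 ∷ 1 ∷ 2 ∷ []

count321-3412 : ∀ {n} → Permutation′ (suc n) → ℕ
count321-3412 w = countNOcc p321 w ℕ.+ countNOcc p3412 w

data Φ : (k : ℕ) → Vec ℕ k → Set where
  φ4321  : Φ 4 (4 ∷ 3 ∷ 2 ∷ 1 ∷ [])
  φ34512 : Φ 5 (3 ∷ 4 ∷ 5 ∷ 1 ∷ 2 ∷ [])
  φ45123 : Φ 5 (4 ∷ 5 ∷ 1 ∷ 2 ∷ 3 ∷ [])
  φ35412 : Φ 5 (3 ∷ 5 ∷ 4 ∷ 1 ∷ 2 ∷ [])
  φ43512 : Φ 5 (4 ∷ 3 ∷ 5 ∷ 1 ∷ 2 ∷ [])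
  φ45132 : Φ 5 (4 ∷ 5 ∷ 1 ∷ 3 ∷ 2 ∷ [])
  φ45213 : Φ 5 (4 ∷ 5 ∷ 2 ∷ 1 ∷ 3 ∷ [])
  φ53412 : Φ 5 (5 ∷ 3 ∷ 4 ∷ 1 ∷ 2 ∷ [])
  φ45312 : Φ 5 (4 ∷ 5 ∷ 3 ∷ 1 ∷ 2 ∷ [])
  φ45231 : Φ 5 (4 ∷ 5 ∷ 2 ∷ 3 ∷ 1 ∷ [])

-- indices of simple reflections of 𝔖_m : the letter j : Gen m stands for
-- s_{toℕ j + 1}, which swaps the (0-based) elements j and j+1 of Fin m.
Gen : ℕ → Set
Gen zero    = ⊥
Gen (suc m) = Fin m

genIndex : ∀ {m} → Gen m → ℕ
genIndex {suc m} j = suc (toℕ j)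

sRefl : ∀ {m} → Gen m → Fin m → Fin m
sRefl {suc m} j = transpose (inject₁ j) (Fin.suc j) ⟨$⟩ʳ_

prod : ∀ {m} → List (Gen m) → Fin m → Fin m
prod []       = id
prod (j ∷ js) = sRefl j ∘ prod js

Represents : ∀ {m} → List (Gen m) → (Fin m → Fin m) → Set
Represents ws u = ∀ x → prod ws x ≡ u x

Reduced : ∀ {m} → List (Gen m) → (Fin m → Fin m) → Set
Reduced {m} ws u =
  Represents ws u × (∀ (vs : List (Gen m)) → length vs ℕ.< length ws → ¬ Represents vs u)

InSupp : ∀ {m} → ℕ → (Fin m → Fin m) → Set
InSupp {m} k u = ∃ λ (ws : List (Gen m)) → Reduced ws u × Any (λ j → genIndex j ≡ k) ws

-- w̄ ∈ 𝔖_{N-1}: delete the letter N from the one-line notation of w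
-- (stdlib  remove i π  deletes position i and value π(i), renumbering)
wbar : ∀ {n} → Permutation′ (suc n) → Permutation′ n
wbar {n} w = remove (w ⟨$⟩ˡ fromℕ n) w

-- k ∈ newrep(w)  iff  s_k ∈ supp(w̄) and w⁻¹(N) ≤ k   (w⁻¹(N) taken 1-based)
NewRep : ∀ {n} → Permutation′ (suc n) → ℕ → Set
NewRep {n} w k = InSupp k (wbar w ⟨$⟩ʳ_) × suc (toℕ (w ⟨$⟩ˡ fromℕ n)) ≤ k

-- s_k ∈ supp(u) iff u does not map {1, …, k} onto itself. Bubble sort writes u with inv(u) simple
-- reflections, which is minimal since each letter changes inv by at most one; and if u fixes {1, …, k}
-- setwise, deleting the first s_k from a reduced word and re-sorting the rest gives a shorter word.
-- For w̄ this says: k ∈ newrep(w) iff w⁻¹(N) ≤ k and w(J) ≤ k for some position J ≥ k + 2.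
-- Avoiding Φ makes such a J unique, so |newrep(w)| = Σ_J c_J, where c_J counts the k with
-- w⁻¹(N) ≤ k ≤ J − 2 and w(J) ≤ k. Splitting the letters before J by position and by value shows,
-- again by avoidance, that c_J is the number of 321-N-occurrences N⋯i⋯J plus (letters before N
-- above w(J)) · (letters between N and J below w(J)), the number of 3412-N-occurrences ending at J.
module Submission where

open import Defs
open import Data.Nat using (ℕ; suc)
open import Data.Vec using (Vec)
open import Data.List using (List; length)
open import Data.List.Membership.Propositional using (_∈_)
open import Data.List.Relation.Unary.Unique.Propositional using (Unique)
open import Data.Fin.Permutation using (Permutation′)
open import Data.Product using (Σ; _×_)
open import Function.Bundles using (_⇔_)
open import Function.Bundles using (mk⇔; Equivalence)
open import Function.Properties.Equivalence using () renaming (trans to ⇔-trans; sym to ⇔-sym)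
open import Relation.Binary.PropositionalEquality using (_≡_)

open import Data.Nat using (zero; _+_; _*_; _∸_; _≤_; _<_; z≤n; s≤s; _⊔_; _⊓_)
import Data.Nat.Properties as ℕP
open import Data.Nat.Tactic.RingSolver using (solve-∀)
open import Data.Fin as Fin using (Fin; toℕ; inject₁)
open import Data.Fin.Patterns using (0F; 1F; 2F; 3F; 4F)
import Data.Fin.Properties as FinP
open import Data.Product using (∃; _,_; proj₁; proj₂)
open import Data.Sum as Sum using (_⊎_; inj₁; inj₂; [_,_]′)
open import Data.Empty using (⊥; ⊥-elim)
open import Data.Vec as Vec using ([]; _∷_; lookup)
open import Data.Vec.Properties using (lookup-map)
open import Data.Vec.Relation.Unary.Linked using (Linked; []; _∷_; [-])
import Data.Vec.Relation.Unary.Linked.Properties as LinkedP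
open import Data.List as List using (filter; tabulate; concatMap; _++_)
open import Data.List.Relation.Unary.All as All using (All)
open import Data.List.Relation.Unary.All.Properties using (All¬⇒¬Any; ¬Any⇒All¬)
open import Data.List.Relation.Unary.Any as Any using (Any)
open import Data.List.Relation.Unary.First using (FirstView; _++_∷_)
open import Data.List.Relation.Unary.First.Properties using (¬All⇒First; toView)
import Data.List.Properties as ListP
import Data.List.Relation.Unary.Unique.Propositional.Properties as UniqueP
import Data.List.Membership.Propositional.Properties as MemberP
open import Function using (_∘_; id)
open import Relation.Binary.PropositionalEquality
  using (refl; sym; trans; cong; cong₂; subst; subst₂; _≢_; module ≡-Reasoning)
open import Relation.Nullary using (Dec; yes; no; ¬_; _×-dec_)
open import Relation.Nullary.Decidable using (True; toWitness; decidable-stable; ¬?; map′; toSum)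
open import Relation.Unary using (Pred; Decidable)
open import Relation.Binary using (tri<; tri≈; tri>)
open import Data.Fin.Permutation as Perm using (_⟨$⟩ʳ_; _⟨$⟩ˡ_; inverseˡ; inverseʳ; transpose; _∘ₚ_)
open import Algebra.Properties.CommutativeMonoid.Sum ℕP.+-0-commutativeMonoid
  using (sum; sum-cong-≗) renaming (∑-distrib-+ to sum-distrib-+; ∑-comm to sum-comm; ∑-permute to sum-permute)
open import Algebra.Properties.Semiring.Sum ℕP.+-*-semiring
  using (*-distribˡ-sum; *-distribʳ-sum)

-- Finite sums and counting

[_] : ∀ {a} {A : Set a} → Dec A → ℕ
[ yes _ ] = 1
[ no _ ] = 0

[]-yes : ∀ {a} {A : Set a} (d : Dec A) → A → [ d ] ≡ 1
[]-yes (yes _) _ = refl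
[]-yes (no ¬a) a = ⊥-elim (¬a a)

[]-no : ∀ {a} {A : Set a} (d : Dec A) → ¬ A → [ d ] ≡ 0
[]-no (yes a) ¬a = ⊥-elim (¬a a)
[]-no (no _) _ = refl

[]-pos : ∀ {a} {A : Set a} (d : Dec A) → 1 ≤ [ d ] → A
[]-pos (yes a) _ = a
[]-pos (no _) ()

[]-⇔ : ∀ {a b} {A : Set a} {B : Set b} (d : Dec A) (e : Dec B) → (A → B) → (B → A) → [ d ] ≡ [ e ]
[]-⇔ (yes _) (yes _) f g = refl
[]-⇔ (yes a) (no ¬b) f g = ⊥-elim (¬b (f a))
[]-⇔ (no ¬a) (yes b) f g = ⊥-elim (¬a (g b))
[]-⇔ (no _) (no _) f g = refl

[]-× : ∀ {a b} {A : Set a} {B : Set b} (d : Dec A) (e : Dec B) (f : Dec (A × B)) → [ f ] ≡ [ d ] * [ e ]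
[]-× (yes a) (yes b) f = []-yes f (a , b)
[]-× (yes a) (no ¬b) f = []-no f (¬b ∘ proj₂)
[]-× (no ¬a) e f = []-no f (¬a ∘ proj₁)

[]-⊎ : ∀ {a b c} {A : Set a} {B : Set b} {C : Set c} (d : Dec A) (e : Dec B) (f : Dec C) →
  (A → B ⊎ C) → (B → A) → (C → A) → (B → C → ⊥) → [ d ] ≡ [ e ] + [ f ]
[]-⊎ (yes a) (yes b) (yes c) _ _ _ disj = ⊥-elim (disj b c)
[]-⊎ (yes a) (yes b) (no _) _ _ _ _ = refl
[]-⊎ (yes a) (no _) (yes c) _ _ _ _ = refl
[]-⊎ (yes a) (no ¬b) (no ¬c) split _ _ _ = ⊥-elim ([ ¬b , ¬c ]′ (split a))
[]-⊎ (no ¬a) (yes b) _ _ b⇒a _ _ = ⊥-elim (¬a (b⇒a b))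
[]-⊎ (no ¬a) (no _) (yes c) _ _ c⇒a _ = ⊥-elim (¬a (c⇒a c))
[]-⊎ (no _) (no _) (no _) _ _ _ _ = refl

[]≡ : ∀ {a} {A : Set a} (d : Dec A) x → x ≤ 1 → (A → 1 ≤ x) → (1 ≤ x → A) → [ d ] ≡ x
[]≡ (yes a) zero _ a⇒x _ with a⇒x a
... | ()
[]≡ (yes _) (suc zero) _ _ _ = refl
[]≡ (yes _) (suc (suc _)) (s≤s ()) _ _
[]≡ (no _) zero _ _ _ = refl
[]≡ (no ¬a) (suc x) _ _ x⇒a = ⊥-elim (¬a (x⇒a (s≤s z≤n)))

-- Sums over Fin m; opaque so that a sum over Fin (suc m) is never unfolded during unification.
opaque
  ∑ : ∀ {m} → (Fin m → ℕ) → ℕ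
  ∑ = sum

opaque
  unfolding ∑

  ∑-empty : (f : Fin 0 → ℕ) → ∑ f ≡ 0
  ∑-empty f = refl

  ∑-suc : ∀ {m} (f : Fin (suc m) → ℕ) → ∑ f ≡ f Fin.zero + ∑ (f ∘ Fin.suc)
  ∑-suc f = refl

  ∑-+ : ∀ {m} (f g : Fin m → ℕ) → ∑ (λ i → f i + g i) ≡ ∑ f + ∑ g
  ∑-+ = sum-distrib-+

  ∑-comm : ∀ {m k} (f : Fin m → Fin k → ℕ) → ∑ (λ i → ∑ (λ j → f i j)) ≡ ∑ (λ j → ∑ (λ i → f i j))
  ∑-comm = sum-comm

  ∑-permute : ∀ {m} (f : Fin m → ℕ) (π : Permutation′ m) → ∑ f ≡ ∑ (λ i → f (π ⟨$⟩ʳ i))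
  ∑-permute = sum-permute

  ∑-*ˡ : ∀ {m} c (f : Fin m → ℕ) → ∑ (λ i → c * f i) ≡ c * ∑ f
  ∑-*ˡ c f = sym (*-distribˡ-sum c f)

  ∑-*ʳ : ∀ {m} c (f : Fin m → ℕ) → ∑ (λ i → f i * c) ≡ ∑ f * c
  ∑-*ʳ c f = sym (*-distribʳ-sum c f)

  ∑-cong : ∀ {m} {f g : Fin m → ℕ} → (∀ i → f i ≡ g i) → ∑ f ≡ ∑ g
  ∑-cong {m} {f} {g} = sum-cong-≗ {m} {f} {g}

  ∑-zero : ∀ {m} (f : Fin m → ℕ) → (∀ i → f i ≡ 0) → ∑ f ≡ 0
  ∑-zero {zero} f _ = refl
  ∑-zero {suc m} f f≡0 rewrite f≡0 Fin.zero = ∑-zero (f ∘ Fin.suc) (f≡0 ∘ Fin.suc)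

  ∑-single : ∀ {m} (i₀ : Fin m) (f : Fin m → ℕ) → (∀ i → i ≢ i₀ → f i ≡ 0) → ∑ f ≡ f i₀
  ∑-single {suc m} Fin.zero f off rewrite ∑-zero (f ∘ Fin.suc) (λ i → off (Fin.suc i) (λ ())) = ℕP.+-identityʳ _
  ∑-single {suc m} (Fin.suc i₀) f off rewrite off Fin.zero (λ ()) =
    ∑-single i₀ (f ∘ Fin.suc) (λ i i≢i₀ → off (Fin.suc i) (i≢i₀ ∘ FinP.suc-injective))

  term≤∑ : ∀ {m} (f : Fin m → ℕ) (i : Fin m) → f i ≤ ∑ f
  term≤∑ {suc m} f Fin.zero = ℕP.m≤m+n _ _
  term≤∑ {suc m} f (Fin.suc i) = ℕP.≤-trans (term≤∑ (f ∘ Fin.suc) i) (ℕP.m≤n+m _ (f Fin.zero))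

  ∑-mono-≤ : ∀ {m} {f g : Fin m → ℕ} → (∀ i → f i ≤ g i) → ∑ f ≤ ∑ g
  ∑-mono-≤ {zero} _ = z≤n
  ∑-mono-≤ {suc m} f≤g = ℕP.+-mono-≤ (f≤g Fin.zero) (∑-mono-≤ (f≤g ∘ Fin.suc))

  ∑-tight : ∀ {m} (f g : Fin m → ℕ) → (∀ i → f i ≤ g i) → ∑ f ≡ ∑ g → ∀ i → f i ≡ g i
  ∑-tight {suc m} f g f≤g eq Fin.zero =
    ℕP.≤-antisym (f≤g Fin.zero) (ℕP.+-cancelʳ-≤ (∑ (f ∘ Fin.suc)) _ _
      (ℕP.≤-trans (ℕP.+-monoʳ-≤ (g Fin.zero) (∑-mono-≤ (f≤g ∘ Fin.suc))) (ℕP.≤-reflexive (sym eq))))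
  ∑-tight {suc m} f g f≤g eq (Fin.suc i) =
    ∑-tight (f ∘ Fin.suc) (g ∘ Fin.suc) (f≤g ∘ Fin.suc)
      (ℕP.≤-antisym (∑-mono-≤ (f≤g ∘ Fin.suc))
        (ℕP.+-cancelˡ-≤ (f Fin.zero) _ _
          (ℕP.≤-trans (ℕP.+-monoˡ-≤ (∑ (g ∘ Fin.suc)) (f≤g Fin.zero)) (ℕP.≤-reflexive (sym eq))))) i

  count⇒witness : ∀ {m a} {A : Fin m → Set a} (d : ∀ i → Dec (A i)) → 1 ≤ ∑ (λ i → [ d i ]) → ∃ A
  count⇒witness {suc m} d pos with d Fin.zero
  ... | yes a = Fin.zero , a
  ... | no _ = let (i , a) = count⇒witness (d ∘ Fin.suc) pos in Fin.suc i , a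

  count⇒two-witnesses : ∀ {m a} {A : Fin m → Set a} (d : ∀ i → Dec (A i)) → 2 ≤ ∑ (λ i → [ d i ]) →
    Σ (Fin m) λ i → Σ (Fin m) λ j → toℕ i < toℕ j × A i × A j
  count⇒two-witnesses {suc m} d two with d Fin.zero
  ... | yes a = let (j , b) = count⇒witness (d ∘ Fin.suc) (ℕP.≤-pred two) in Fin.zero , Fin.suc j , s≤s z≤n , a , b
  ... | no _ = let (i , j , i<j , a , b) = count⇒two-witnesses (d ∘ Fin.suc) two in Fin.suc i , Fin.suc j , s≤s i<j , a , b

count≤1 : ∀ {m a} {A : Fin m → Set a} (d : ∀ i → Dec (A i)) →
  (∀ i j → toℕ i < toℕ j → A i → A j → ⊥) → ∑ (λ i → [ d i ]) ≤ 1
count≤1 d atMostOne with 2 ℕP.≤? ∑ (λ i → [ d i ])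
... | yes two = let (i , j , i<j , a , b) = count⇒two-witnesses d two in ⊥-elim (atMostOne i j i<j a b)
... | no ¬two = ℕP.≤-pred (ℕP.≰⇒> ¬two)

count-none : ∀ {m a} {A : Fin m → Set a} (d : ∀ i → Dec (A i)) → (∀ i → ¬ A i) → ∑ (λ i → [ d i ]) ≡ 0
count-none d none = ∑-zero _ (λ i → []-no (d i) (none i))

∑-indicator : ∀ {m} (i₀ : Fin m) → ∑ (λ i → [ i Fin.≟ i₀ ]) ≡ 1
∑-indicator i₀ = trans (∑-single i₀ _ (λ i i≢i₀ → []-no (i Fin.≟ i₀) i≢i₀)) ([]-yes (i₀ Fin.≟ i₀) refl)

∑-select : ∀ {m} (i₀ : Fin m) (c : ℕ) → ∑ (λ i → [ i Fin.≟ i₀ ] * c) ≡ c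
∑-select i₀ c = trans (∑-*ʳ c _) (trans (cong (_* c) (∑-indicator i₀)) (ℕP.*-identityˡ c))

two-witnesses⇒count : ∀ {m a} {A : Fin m → Set a} (d : ∀ i → Dec (A i)) {i j} → i ≢ j → A i → A j →
  2 ≤ ∑ (λ x → [ d x ])
two-witnesses⇒count d {i} {j} i≢j ai aj =
  ℕP.≤-trans (ℕP.≤-reflexive (sym two)) (∑-mono-≤ pointwise)
  where
  two : ∑ (λ x → [ x Fin.≟ i ] + [ x Fin.≟ j ]) ≡ 2
  two = trans (∑-+ _ _) (cong₂ _+_ (∑-indicator i) (∑-indicator j))
  pointwise : ∀ x → [ x Fin.≟ i ] + [ x Fin.≟ j ] ≤ [ d x ]
  pointwise x with x Fin.≟ i | x Fin.≟ j
  ... | yes refl | yes refl = ⊥-elim (i≢j refl)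
  ... | yes refl | no _ = ℕP.≤-reflexive (sym ([]-yes (d x) ai))
  ... | no _ | yes refl = ℕP.≤-reflexive (sym ([]-yes (d x) aj))
  ... | no _ | no _ = z≤n

count-< : ∀ {m} b → b ≤ m → ∑ (λ (i : Fin m) → [ toℕ i ℕP.<? b ]) ≡ b
count-< {zero} zero _ = ∑-empty _
count-< {suc m} zero _ = ∑-zero _ (λ i → []-no (toℕ i ℕP.<? 0) λ ())
count-< {suc m} (suc b) (s≤s b≤m) = trans (∑-suc _)
  (cong₂ _+_ ([]-yes (0 ℕP.<? suc b) (s≤s z≤n))
    (trans (∑-cong (λ i → []-⇔ (suc (toℕ i) ℕP.<? suc b) (toℕ i ℕP.<? b) ℕP.≤-pred s≤s)) (count-< b b≤m)))

count-between : ∀ {m} a b → b ≤ m → ∑ (λ (i : Fin m) → [ a ℕP.<? toℕ i ×-dec toℕ i ℕP.<? b ]) ≡ b ∸ suc a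
count-between a zero _ = ∑-zero _ (λ i → []-no (a ℕP.<? toℕ i ×-dec toℕ i ℕP.<? 0) (λ ()))
count-between {suc m} zero (suc b) (s≤s b≤m) = trans (∑-suc _)
  (cong₂ _+_ ([]-no (0 ℕP.<? 0 ×-dec 0 ℕP.<? suc b) (λ ()))
    (trans (∑-cong (λ i → []-⇔ (0 ℕP.<? suc (toℕ i) ×-dec suc (toℕ i) ℕP.<? suc b) (toℕ i ℕP.<? b)
                          (ℕP.≤-pred ∘ proj₂) (λ i<b → s≤s z≤n , s≤s i<b)))
           (count-< b b≤m)))
count-between {suc m} (suc a) (suc b) (s≤s b≤m) = trans (∑-suc _)
  (cong₂ _+_ ([]-no (suc a ℕP.<? 0 ×-dec 0 ℕP.<? suc b) (λ ()))
    (trans (∑-cong (λ i → []-⇔ (suc a ℕP.<? suc (toℕ i) ×-dec suc (toℕ i) ℕP.<? suc b)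
                               (a ℕP.<? toℕ i ×-dec toℕ i ℕP.<? b)
                          (λ (x , y) → ℕP.≤-pred x , ℕP.≤-pred y) (λ (x , y) → s≤s x , s≤s y)))
           (count-between a b b≤m)))

length-filter-∷ : ∀ {a p} {A : Set a} {P : Pred A p} (P? : Decidable P) x (xs : List A) →
  length (filter P? (x List.∷ xs)) ≡ [ P? x ] + length (filter P? xs)
length-filter-∷ P? x xs with P? x
... | yes _ = refl
... | no _ = refl

length-filter-map : ∀ {a b p} {A : Set a} {B : Set b} {P : Pred B p} (P? : Decidable P) (g : A → B) (xs : List A) →
  length (filter P? (List.map g xs)) ≡ length (filter (P? ∘ g) xs)
length-filter-map P? g List.[] = refl
length-filter-map P? g (x List.∷ xs) with P? (g x)
... | yes _ = cong suc (length-filter-map P? g xs)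
... | no _ = length-filter-map P? g xs

length-filter-tabulate : ∀ {a p} {A : Set a} {P : Pred A p} (P? : Decidable P) {m} (f : Fin m → A) →
  length (filter P? (tabulate f)) ≡ ∑ (λ i → [ P? (f i) ])
length-filter-tabulate P? {zero} f = sym (∑-empty _)
length-filter-tabulate P? {suc m} f =
  trans (length-filter-∷ P? (f Fin.zero) (tabulate (f ∘ Fin.suc)))
    (trans (cong ([ P? (f Fin.zero) ] +_) (length-filter-tabulate P? (f ∘ Fin.suc))) (sym (∑-suc _)))

length-filter-concatMap-tabulate : ∀ {a b p} {A : Set a} {B : Set b} {P : Pred B p} (P? : Decidable P)
  (g : A → List B) {m} (f : Fin m → A) →
  length (filter P? (concatMap g (tabulate f))) ≡ ∑ (λ i → length (filter P? (g (f i))))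
length-filter-concatMap-tabulate P? g {zero} f = sym (∑-empty _)
length-filter-concatMap-tabulate P? g {suc m} f = begin
  length (filter P? (g (f Fin.zero) ++ rest))
    ≡⟨ cong length (ListP.filter-++ P? (g (f Fin.zero)) rest) ⟩
  length (filter P? (g (f Fin.zero)) ++ filter P? rest)
    ≡⟨ ListP.length-++ (filter P? (g (f Fin.zero))) ⟩
  length (filter P? (g (f Fin.zero))) + length (filter P? rest)
    ≡⟨ cong (length (filter P? (g (f Fin.zero))) +_) (length-filter-concatMap-tabulate P? g (f ∘ Fin.suc)) ⟩
  length (filter P? (g (f Fin.zero))) + ∑ (λ i → length (filter P? (g (f (Fin.suc i)))))
    ≡⟨ ∑-suc _ ⟨
  ∑ (λ i → length (filter P? (g (f i)))) ∎
  where
  open ≡-Reasoning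
  rest = concatMap g (tabulate (f ∘ Fin.suc))

count-allVecs-suc : ∀ {N p} k {P : Pred (Vec (Fin N) (suc k)) p} (P? : Decidable P) →
  length (filter P? (allVecs (suc k))) ≡ ∑ (λ i → length (filter (λ v → P? (i ∷ v)) (allVecs k)))
count-allVecs-suc k P? =
  trans (length-filter-concatMap-tabulate P? (λ i → List.map (i ∷_) (allVecs k)) id)
        (∑-cong (λ i → length-filter-map P? (i ∷_) (allVecs k)))

count-allVecs-zero : ∀ {N p} {P : Pred (Vec (Fin N) 0) p} (P? : Decidable P) →
  length (filter P? (allVecs 0)) ≡ [ P? [] ]
count-allVecs-zero P? with P? []
... | yes _ = refl
... | no _ = refl

countNOcc-∑₃ : ∀ {n} (p : Vec ℕ 3) (w : Permutation′ (suc n)) →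
  countNOcc p w ≡ ∑ λ a → ∑ λ b → ∑ λ c → [ NOcc? p w (a ∷ b ∷ c ∷ []) ]
countNOcc-∑₃ p w =
  trans (count-allVecs-suc 2 (NOcc? p w)) (∑-cong λ a →
  trans (count-allVecs-suc 1 (λ u → NOcc? p w (a ∷ u))) (∑-cong λ b →
  trans (count-allVecs-suc 0 (λ u → NOcc? p w (a ∷ b ∷ u))) (∑-cong λ c →
  count-allVecs-zero (λ u → NOcc? p w (a ∷ b ∷ c ∷ u)))))

countNOcc-∑₄ : ∀ {n} (p : Vec ℕ 4) (w : Permutation′ (suc n)) →
  countNOcc p w ≡ ∑ λ a → ∑ λ b → ∑ λ c → ∑ λ d → [ NOcc? p w (a ∷ b ∷ c ∷ d ∷ []) ]
countNOcc-∑₄ p w =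
  trans (count-allVecs-suc 3 (NOcc? p w)) (∑-cong λ a →
  trans (count-allVecs-suc 2 (λ u → NOcc? p w (a ∷ u))) (∑-cong λ b →
  trans (count-allVecs-suc 1 (λ u → NOcc? p w (a ∷ b ∷ u))) (∑-cong λ c →
  trans (count-allVecs-suc 0 (λ u → NOcc? p w (a ∷ b ∷ c ∷ u))) (∑-cong λ d →
  count-allVecs-zero (λ u → NOcc? p w (a ∷ b ∷ c ∷ d ∷ u))))))

enumerate : ∀ {m p} {P : ℕ → Set p} (P? : (i : Fin m) → Dec (P (toℕ i))) → (∀ k → P k → k < m) →
  Σ (List ℕ) λ L → Unique L × (∀ k → (k ∈ L) ⇔ P k) × length L ≡ ∑ (λ i → [ P? i ])
enumerate {m} {P = P} P? bounded =
  L , UniqueP.map⁺ FinP.toℕ-injective (UniqueP.filter⁺ P? (UniqueP.allFin⁺ m)) ,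
  (λ k → mk⇔ (member⇒ k) (⇒member k)) ,
  trans (ListP.length-map toℕ (filter P? (List.allFin m))) (length-filter-tabulate P? id)
  where
  L : List ℕ
  L = List.map toℕ (filter P? (List.allFin m))
  member⇒ : ∀ k → k ∈ L → P k
  member⇒ k k∈L with MemberP.∈-map⁻ toℕ k∈L
  ... | i , i∈ , refl = proj₂ (MemberP.∈-filter⁻ P? {xs = List.allFin m} i∈)
  ⇒member : ∀ k → P k → k ∈ L
  ⇒member k pk = subst (_∈ L) (FinP.toℕ-fromℕ< k<m)
    (MemberP.∈-map⁺ toℕ (MemberP.∈-filter⁺ P? (MemberP.∈-allFin i) (subst P (sym (FinP.toℕ-fromℕ< k<m)) pk)))
    where
    k<m = bounded k pk
    i = Fin.fromℕ< k<m

-- Pattern occurrences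

-- σ lists the positions of the values 1, …, k of the pattern p.
record Sorts {k} (p : Vec ℕ k) (σ : Vec (Fin k) k) : Set where
  constructor sorting
  field
    rank : ∀ i → lookup p (lookup σ i) ≡ suc (toℕ i)
    onto : ∀ a → ∃ λ i → lookup σ i ≡ a

sorts? : ∀ {k} (p : Vec ℕ k) (σ : Vec (Fin k) k) → Dec (Sorts p σ)
sorts? p σ = map′ (λ (r , o) → sorting r o) (λ (sorting r o) → r , o)
  (FinP.all? (λ i → lookup p (lookup σ i) ℕP.≟ suc (toℕ i))
   ×-dec FinP.all? (λ a → FinP.any? (λ i → lookup σ i Fin.≟ a)))

sorts : ∀ {k} (p : Vec ℕ k) (σ : Vec (Fin k) k) {sorted : True (sorts? p σ)} → Sorts p σ
sorts p σ {sorted} = toWitness sorted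

sameOrder-by-sorting : ∀ {N k} {p : Vec ℕ k} {σ : Vec (Fin k) k} → Sorts p σ →
  (w : Permutation′ N) (is : Vec (Fin N) k) →
  Linked Fin._<_ (Vec.map (λ a → w ⟨$⟩ʳ lookup is a) σ) → SameOrder p w is
sameOrder-by-sorting {N} {k} {p} {σ} (sorting rank onto) w is chain a b with onto a | onto b
... | i , refl | j , refl = forward , backward
  where
  u : Fin k → Fin N
  u a = w ⟨$⟩ʳ lookup is a
  ordered : ∀ {i j} → i Fin.< j → u (lookup σ i) Fin.< u (lookup σ j)
  ordered {i} {j} i<j =
    subst₂ Fin._<_ (lookup-map i u σ) (lookup-map j u σ) (LinkedP.lookup⁺ FinP.<-trans chain i<j)
  forward : lookup p (lookup σ i) < lookup p (lookup σ j) → u (lookup σ i) Fin.< u (lookup σ j)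
  forward lt = ordered (ℕP.≤-pred (subst₂ _<_ (rank i) (rank j) lt))
  backward : u (lookup σ i) Fin.< u (lookup σ j) → lookup p (lookup σ i) < lookup p (lookup σ j)
  backward lt with FinP.<-cmp i j
  ... | tri< i<j _ _ = subst₂ _<_ (sym (rank i)) (sym (rank j)) (s≤s i<j)
  ... | tri≈ _ refl _ = ⊥-elim (ℕP.<-irrefl refl lt)
  ... | tri> _ _ j<i = ⊥-elim (ℕP.<-asym lt (ordered j<i))

nOcc-by-sorting : ∀ {n k} {p : Vec ℕ k} {σ : Vec (Fin k) k} → Sorts p σ →
  (w : Permutation′ (suc n)) (is : Vec (Fin (suc n)) k) →
  Linked Fin._<_ is → Linked Fin._<_ (Vec.map (λ a → w ⟨$⟩ʳ lookup is a) σ) → HasTopValue w is →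
  NOcc p w is
nOcc-by-sorting {p = p} {σ} sorted w is increasing chain top =
  (λ _ _ → LinkedP.lookup⁺ FinP.<-trans increasing) , sameOrder-by-sorting {p = p} {σ} sorted w is chain , top

linked-by-lookup : ∀ {a r} {A : Set a} {R : A → A → Set r} {k} (xs : Vec A k) →
  (∀ {i j : Fin k} → i Fin.< j → R (lookup xs i) (lookup xs j)) → Linked R xs
linked-by-lookup [] _ = []
linked-by-lookup (x ∷ []) _ = [-]
linked-by-lookup (x ∷ y ∷ xs) R-ordered =
  R-ordered {0F} {1F} (s≤s z≤n) ∷ linked-by-lookup (y ∷ xs) (R-ordered ∘ s≤s)

nOcc⇒chains : ∀ {n k} {p : Vec ℕ k} {σ : Vec (Fin k) k} → Sorts p σ →
  (w : Permutation′ (suc n)) (is : Vec (Fin (suc n)) k) → NOcc p w is →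
  Linked Fin._<_ is × Linked Fin._<_ (Vec.map (λ a → w ⟨$⟩ʳ lookup is a) σ)
nOcc⇒chains {p = p} {σ} (sorting rank _) w is (increasing , sameOrder , _) =
  linked-by-lookup is (increasing _ _) ,
  linked-by-lookup (Vec.map (λ a → w ⟨$⟩ʳ lookup is a) σ) (λ {i} {j} i<j →
    subst₂ Fin._<_ (sym (lookup-map i _ σ)) (sym (lookup-map j _ σ))
      (proj₁ (sameOrder (lookup σ i) (lookup σ j)) (subst₂ _<_ (sym (rank i)) (sym (rank j)) (s≤s i<j))))

nOcc-top : ∀ {n k} {p : Vec ℕ (suc k)} {σ : Vec (Fin (suc k)) (suc k)} → Sorts p σ →
  (w : Permutation′ (suc n)) (is : Vec (Fin (suc n)) (suc k)) → NOcc p w is →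
  w ⟨$⟩ʳ lookup is (lookup σ (Fin.fromℕ k)) ≡ Fin.fromℕ n
nOcc-top {n} {k} {p} {σ} (sorting rank onto) w is (_ , sameOrder , a , wa≡N) with onto a
... | i , refl = FinP.toℕ-injective (ℕP.≤-antisym
  (subst (toℕ (w ⟨$⟩ʳ lookup is last) ≤_) (sym (FinP.toℕ-fromℕ n))
         (FinP.toℕ≤pred[n] (w ⟨$⟩ʳ lookup is last)))
  (subst (_≤ toℕ (w ⟨$⟩ʳ lookup is last)) (cong toℕ wa≡N)
    (ℕP.≮⇒≥ λ lt → ℕP.<⇒≱ (proj₂ (sameOrder last (lookup σ i)) lt) rank≤)))
  where
  last : Fin (suc k)
  last = lookup σ (Fin.fromℕ k)
  rank≤ : lookup p (lookup σ i) ≤ lookup p last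
  rank≤ = subst₂ _≤_ (sym (rank i)) (sym (trans (rank (Fin.fromℕ k)) (cong suc (FinP.toℕ-fromℕ k))))
                (s≤s (FinP.toℕ≤pred[n] i))

-- Inversions and reduced words

⟨$⟩ʳ-injective : ∀ {m} (π : Permutation′ m) {x y} → π ⟨$⟩ʳ x ≡ π ⟨$⟩ʳ y → x ≡ y
⟨$⟩ʳ-injective π {x} {y} eq = trans (sym (inverseˡ π)) (trans (cong (π ⟨$⟩ˡ_) eq) (inverseˡ π))

swapℕ : ℕ → ℕ → ℕ
swapℕ c t with t ℕP.≟ c
... | yes _ = suc c
... | no _ with t ℕP.≟ suc c
...   | yes _ = c
...   | no _ = t

swapℕ-c : ∀ c → swapℕ c c ≡ suc c
swapℕ-c c with c ℕP.≟ c
... | yes _ = refl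
... | no c≢c = ⊥-elim (c≢c refl)

swapℕ-suc : ∀ c → swapℕ c (suc c) ≡ c
swapℕ-suc c with suc c ℕP.≟ c
... | yes eq = ⊥-elim (ℕP.<-irrefl (sym eq) (ℕP.n<1+n c))
... | no _ with suc c ℕP.≟ suc c
...   | yes _ = refl
...   | no ne = ⊥-elim (ne refl)

swapℕ-other : ∀ c t → t ≢ c → t ≢ suc c → swapℕ c t ≡ t
swapℕ-other c t t≢c t≢sc with t ℕP.≟ c
... | yes eq = ⊥-elim (t≢c eq)
... | no _ with t ℕP.≟ suc c
...   | yes eq = ⊥-elim (t≢sc eq)
...   | no _ = refl

swapℕ-involutive : ∀ c t → swapℕ c (swapℕ c t) ≡ t
swapℕ-involutive c t with t ℕP.≟ c
... | yes refl = swapℕ-suc c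
... | no t≢c with t ℕP.≟ suc c
...   | yes refl = swapℕ-c c
...   | no t≢sc = swapℕ-other c t t≢c t≢sc

swapℕ-mono-< : ∀ c s t → ¬ (s ≡ c × t ≡ suc c) → ¬ (s ≡ suc c × t ≡ c) → s < t → swapℕ c s < swapℕ c t
swapℕ-mono-< c s t ¬cs ¬sc s<t with s ℕP.≟ c | t ℕP.≟ c
... | yes refl | yes refl = ⊥-elim (ℕP.<-irrefl refl s<t)
... | yes refl | no t≢c with t ℕP.≟ suc c
...   | yes eq = ⊥-elim (¬cs (refl , eq))
...   | no t≢sc = ℕP.≤∧≢⇒< s<t (t≢sc ∘ sym)
swapℕ-mono-< c s t ¬cs ¬sc s<t | no s≢c | yes refl with s ℕP.≟ suc c
...   | yes refl = ⊥-elim (ℕP.<-asym s<t (ℕP.n<1+n c))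
...   | no _ = ℕP.<-trans s<t (ℕP.n<1+n c)
swapℕ-mono-< c s t ¬cs ¬sc s<t | no s≢c | no t≢c with s ℕP.≟ suc c | t ℕP.≟ suc c
... | yes refl | yes refl = ⊥-elim (ℕP.<-irrefl refl s<t)
... | yes refl | no _ = ℕP.<-trans (ℕP.n<1+n c) s<t
... | no _ | yes refl = ℕP.≤∧≢⇒< (ℕP.≤-pred s<t) s≢c
... | no _ | no _ = s<t

swapℕ-cancel-< : ∀ c s t → ¬ (s ≡ c × t ≡ suc c) → ¬ (s ≡ suc c × t ≡ c) → swapℕ c s < swapℕ c t → s < t
swapℕ-cancel-< c s t ¬cs ¬sc lt with ℕP.<-cmp s t
... | tri< s<t _ _ = s<t
... | tri≈ _ refl _ = ⊥-elim (ℕP.<-irrefl refl lt)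
... | tri> _ _ t<s =
  ⊥-elim (ℕP.<-asym lt (swapℕ-mono-< c t s (λ (e₁ , e₂) → ¬sc (e₂ , e₁)) (λ (e₁ , e₂) → ¬cs (e₂ , e₁)) t<s))

swapℕ-≤ : ∀ c t k → suc c ≢ k → k ≤ swapℕ c t → k ≤ t
swapℕ-≤ c t k sc≢k k≤ with t ℕP.≟ c
... | yes refl = ℕP.≤-pred (ℕP.≤∧≢⇒< k≤ (sc≢k ∘ sym))
... | no _ with t ℕP.≟ suc c
...   | yes refl = ℕP.≤-trans k≤ (ℕP.n≤1+n c)
...   | no _ = k≤

≤-swapℕ : ∀ c t k → suc c ≢ k → k ≤ t → k ≤ swapℕ c t
≤-swapℕ c t k sc≢k k≤t = swapℕ-≤ c (swapℕ c t) k sc≢k (subst (k ≤_) (sym (swapℕ-involutive c t)) k≤t)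

toℕ-sRefl : ∀ {m} (j : Fin m) (x : Fin (suc m)) → toℕ (sRefl j x) ≡ swapℕ (toℕ j) (toℕ x)
toℕ-sRefl j x with x Fin.≟ inject₁ j
... | yes refl rewrite FinP.toℕ-inject₁ j = sym (swapℕ-c (toℕ j))
... | no x≢j with x Fin.≟ Fin.suc j
...   | yes refl rewrite FinP.toℕ-inject₁ j = sym (swapℕ-suc (toℕ j))
...   | no x≢sj = sym (swapℕ-other (toℕ j) (toℕ x)
                    (λ eq → x≢j (FinP.toℕ-injective (trans eq (sym (FinP.toℕ-inject₁ j)))))
                    (x≢sj ∘ FinP.toℕ-injective))

sRefl-involutive : ∀ {m} (j : Fin m) (x : Fin (suc m)) → sRefl j (sRefl j x) ≡ x
sRefl-involutive j x = FinP.toℕ-injective (begin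
  toℕ (sRefl j (sRefl j x))             ≡⟨ toℕ-sRefl j (sRefl j x) ⟩
  swapℕ (toℕ j) (toℕ (sRefl j x))        ≡⟨ cong (swapℕ (toℕ j)) (toℕ-sRefl j x) ⟩
  swapℕ (toℕ j) (swapℕ (toℕ j) (toℕ x))  ≡⟨ swapℕ-involutive (toℕ j) (toℕ x) ⟩
  toℕ x                                 ∎)
  where open ≡-Reasoning

sRefl-<-⇔ : ∀ {m} (j : Fin m) (s t : Fin (suc m)) →
  ¬ (toℕ s ≡ toℕ j × toℕ t ≡ suc (toℕ j)) → ¬ (toℕ s ≡ suc (toℕ j) × toℕ t ≡ toℕ j) →
  (toℕ s < toℕ t → toℕ (sRefl j s) < toℕ (sRefl j t)) × (toℕ (sRefl j s) < toℕ (sRefl j t) → toℕ s < toℕ t)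
sRefl-<-⇔ j s t ¬cs ¬sc =
  (λ s<t → subst₂ _<_ (sym (toℕ-sRefl j s)) (sym (toℕ-sRefl j t)) (swapℕ-mono-< (toℕ j) _ _ ¬cs ¬sc s<t)) ,
  (λ lt → swapℕ-cancel-< (toℕ j) _ _ ¬cs ¬sc (subst₂ _<_ (toℕ-sRefl j s) (toℕ-sRefl j t) lt))

inversion? : ∀ {m} (f : Fin m → Fin m) (x y : Fin m) → Dec (toℕ x < toℕ y × toℕ (f y) < toℕ (f x))
inversion? f x y = toℕ x ℕP.<? toℕ y ×-dec toℕ (f y) ℕP.<? toℕ (f x)

inversions : ∀ {m} → (Fin m → Fin m) → ℕ
inversions f = ∑ λ x → ∑ λ y → [ inversion? f x y ]

inversions-cong : ∀ {m} {f g : Fin m → Fin m} → (∀ x → f x ≡ g x) → inversions f ≡ inversions g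
inversions-cong {f = f} {g} f≗g = ∑-cong λ x → ∑-cong λ y → []-⇔ (inversion? f x y) (inversion? g x y)
  (λ (x<y , lt) → x<y , subst₂ (λ u v → toℕ u < toℕ v) (f≗g y) (f≗g x) lt)
  (λ (x<y , lt) → x<y , subst₂ (λ u v → toℕ u < toℕ v) (sym (f≗g y)) (sym (f≗g x)) lt)

inversions-id : ∀ {m} → inversions {m} id ≡ 0
inversions-id = ∑-zero _ λ x → ∑-zero _ λ y → []-no (inversion? id x y) (λ (x<y , y<x) → ℕP.<-asym x<y y<x)

∑∑-bump : ∀ {m} (F G : Fin m → Fin m → ℕ) x₀ y₀ → (∀ x y → ¬ (x ≡ x₀ × y ≡ y₀) → G x y ≡ F x y) →
  G x₀ y₀ ≡ suc (F x₀ y₀) → ∑ (λ x → ∑ (λ y → G x y)) ≡ suc (∑ (λ x → ∑ (λ y → F x y)))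
∑∑-bump {m} F G x₀ y₀ off at = begin
  ∑ (λ x → ∑ (λ y → G x y))
    ≡⟨ ∑-cong (λ x → trans (∑-cong (G≡F+δ x)) (∑-+ (F x) _)) ⟩
  ∑ (λ x → ∑ (F x) + ∑ (λ y → δ x y))
    ≡⟨ ∑-+ (λ x → ∑ (F x)) _ ⟩
  ∑ (λ x → ∑ (F x)) + ∑ (λ x → ∑ (λ y → δ x y))
    ≡⟨ cong (∑ (λ x → ∑ (F x)) +_) ∑∑δ ⟩
  ∑ (λ x → ∑ (F x)) + 1
    ≡⟨ ℕP.+-comm _ 1 ⟩
  suc (∑ (λ x → ∑ (λ y → F x y))) ∎
  where
  open ≡-Reasoning
  δ : Fin m → Fin m → ℕ
  δ x y = [ x Fin.≟ x₀ ×-dec y Fin.≟ y₀ ]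
  G≡F+δ : ∀ x y → G x y ≡ F x y + δ x y
  G≡F+δ x y with x Fin.≟ x₀ ×-dec y Fin.≟ y₀
  ... | yes (refl , refl) = trans at (ℕP.+-comm 1 _)
  ... | no ne = trans (off x y ne) (sym (ℕP.+-identityʳ _))
  ∑∑δ : ∑ (λ x → ∑ (λ y → δ x y)) ≡ 1
  ∑∑δ = trans (∑-cong λ x →
                 trans (∑-single y₀ _ (λ y y≢y₀ → []-no (x Fin.≟ x₀ ×-dec y Fin.≟ y₀) (y≢y₀ ∘ proj₂)))
                       ([]-⇔ (x Fin.≟ x₀ ×-dec y₀ Fin.≟ y₀) (x Fin.≟ x₀) proj₁ (_, refl)))
              (∑-indicator x₀)

-- Composing with s_j creates exactly the inversion between the positions of the values j and j + 1.
inversions-ascent : ∀ {m} (π : Permutation′ (suc m)) (j : Fin m) {a b} →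
  toℕ (π ⟨$⟩ʳ a) ≡ toℕ j → toℕ (π ⟨$⟩ʳ b) ≡ suc (toℕ j) → toℕ a < toℕ b →
  inversions (sRefl j ∘ (π ⟨$⟩ʳ_)) ≡ suc (inversions (π ⟨$⟩ʳ_))
inversions-ascent {m} π j {a} {b} πa πb a<b =
  ∑∑-bump (λ x y → [ inversion? f x y ]) (λ x y → [ inversion? g x y ]) a b unchanged
    (trans ([]-yes (inversion? g a b) (a<b , subst₂ _<_ (sym gb) (sym ga) (ℕP.n<1+n (toℕ j))))
           (cong suc (sym ([]-no (inversion? f a b)
              (λ (_ , lt) → ℕP.<-asym (subst₂ _<_ πb πa lt) (ℕP.n<1+n (toℕ j)))))))
  where
  f g : Fin (suc m) → Fin (suc m)
  f = π ⟨$⟩ʳ_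
  g = sRefl j ∘ f
  ga : toℕ (g a) ≡ suc (toℕ j)
  ga = trans (toℕ-sRefl j (f a)) (trans (cong (swapℕ (toℕ j)) πa) (swapℕ-c (toℕ j)))
  gb : toℕ (g b) ≡ toℕ j
  gb = trans (toℕ-sRefl j (f b)) (trans (cong (swapℕ (toℕ j)) πb) (swapℕ-suc (toℕ j)))
  at : ∀ {x c} → toℕ (f x) ≡ c → ∀ {y} → toℕ (f y) ≡ c → x ≡ y
  at fx fy = ⟨$⟩ʳ-injective π (FinP.toℕ-injective (trans fx (sym fy)))
  unchanged : ∀ x y → ¬ (x ≡ a × y ≡ b) → [ inversion? g x y ] ≡ [ inversion? f x y ]
  unchanged x y ¬ab = []-⇔ (inversion? g x y) (inversion? f x y)
    (λ (x<y , lt) → x<y , proj₂ (order x<y) lt) (λ (x<y , lt) → x<y , proj₁ (order x<y) lt)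
    where
    order : toℕ x < toℕ y →
      (toℕ (f y) < toℕ (f x) → toℕ (g y) < toℕ (g x)) × (toℕ (g y) < toℕ (g x) → toℕ (f y) < toℕ (f x))
    order x<y = sRefl-<-⇔ j (f y) (f x)
      (λ (fy , fx) → ℕP.<-asym a<b (subst₂ (λ u v → toℕ u < toℕ v) (at fx πb) (at fy πa) x<y))
      (λ (fy , fx) → ¬ab (at fx πa , at fy πb))

inversions-descent : ∀ {m} (π : Permutation′ (suc m)) (j : Fin m) {a b} →
  toℕ (π ⟨$⟩ʳ a) ≡ toℕ j → toℕ (π ⟨$⟩ʳ b) ≡ suc (toℕ j) → toℕ b < toℕ a →
  inversions (π ⟨$⟩ʳ_) ≡ suc (inversions (sRefl j ∘ (π ⟨$⟩ʳ_)))
inversions-descent π j {a} {b} πa πb b<a =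
  trans (inversions-cong (λ x → sym (sRefl-involutive j (π ⟨$⟩ʳ x))))
        (inversions-ascent (π ∘ₚ transpose (inject₁ j) (Fin.suc j)) j
          (trans (toℕ-sRefl j (π ⟨$⟩ʳ b)) (trans (cong (swapℕ (toℕ j)) πb) (swapℕ-suc (toℕ j))))
          (trans (toℕ-sRefl j (π ⟨$⟩ʳ a)) (trans (cong (swapℕ (toℕ j)) πa) (swapℕ-c (toℕ j))))
          b<a)

π-at-j : ∀ {m} (π : Permutation′ (suc m)) (j : Fin m) → toℕ (π ⟨$⟩ʳ (π ⟨$⟩ˡ inject₁ j)) ≡ toℕ j
π-at-j π j = trans (cong toℕ (inverseʳ π)) (FinP.toℕ-inject₁ j)

π-at-suc-j : ∀ {m} (π : Permutation′ (suc m)) (j : Fin m) → toℕ (π ⟨$⟩ʳ (π ⟨$⟩ˡ Fin.suc j)) ≡ suc (toℕ j)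
π-at-suc-j π j = cong toℕ (inverseʳ π)

ascent-or-descent : ∀ {m} (π : Permutation′ (suc m)) (j : Fin m) →
  toℕ (π ⟨$⟩ˡ inject₁ j) < toℕ (π ⟨$⟩ˡ Fin.suc j) ⊎ toℕ (π ⟨$⟩ˡ Fin.suc j) < toℕ (π ⟨$⟩ˡ inject₁ j)
ascent-or-descent π j with ℕP.<-cmp (toℕ (π ⟨$⟩ˡ inject₁ j)) (toℕ (π ⟨$⟩ˡ Fin.suc j))
... | tri< lt _ _ = inj₁ lt
... | tri≈ _ eq _ = ⊥-elim (ℕP.1+n≢n (trans (sym (π-at-suc-j π j))
                      (trans (cong (toℕ ∘ (π ⟨$⟩ʳ_)) (sym (FinP.toℕ-injective eq))) (π-at-j π j))))
... | tri> _ _ gt = inj₂ gt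

inversions-sRefl-≤ : ∀ {m} (π : Permutation′ (suc m)) (j : Fin m) →
  inversions (sRefl j ∘ (π ⟨$⟩ʳ_)) ≤ suc (inversions (π ⟨$⟩ʳ_))
inversions-sRefl-≤ π j with ascent-or-descent π j
... | inj₁ a<b = ℕP.≤-reflexive (inversions-ascent π j (π-at-j π j) (π-at-suc-j π j) a<b)
... | inj₂ b<a = ℕP.≤-trans (ℕP.n≤1+n _) (ℕP.≤-trans
      (ℕP.≤-reflexive (sym (inversions-descent π j (π-at-j π j) (π-at-suc-j π j) b<a))) (ℕP.n≤1+n _))

permOfWord : ∀ {m} → List (Fin m) → Permutation′ (suc m)
permOfWord List.[] = Perm.id
permOfWord (j List.∷ js) = permOfWord js ∘ₚ transpose (inject₁ j) (Fin.suc j)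

permOfWord-prod : ∀ {m} (js : List (Fin m)) x → permOfWord js ⟨$⟩ʳ x ≡ prod js x
permOfWord-prod List.[] x = refl
permOfWord-prod (j List.∷ js) x = cong (sRefl j) (permOfWord-prod js x)

prod-++ : ∀ {m} (α β : List (Gen m)) x → prod (α ++ β) x ≡ prod α (prod β x)
prod-++ List.[] β x = refl
prod-++ (j List.∷ α) β x = cong (sRefl j) (prod-++ α β x)

inversions≤length : ∀ {m} (js : List (Fin m)) → inversions (prod js) ≤ length js
inversions≤length List.[] = ℕP.≤-reflexive inversions-id
inversions≤length (j List.∷ js) = begin
  inversions (sRefl j ∘ prod js)                ≡⟨ inversions-cong (cong (sRefl j) ∘ sym ∘ permOfWord-prod js) ⟩
  inversions (sRefl j ∘ (permOfWord js ⟨$⟩ʳ_))   ≤⟨ inversions-sRefl-≤ (permOfWord js) j ⟩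
  suc (inversions (permOfWord js ⟨$⟩ʳ_))          ≡⟨ cong suc (inversions-cong (permOfWord-prod js)) ⟩
  suc (inversions (prod js))                    ≤⟨ s≤s (inversions≤length js) ⟩
  suc (length js)                               ∎
  where open ℕP.≤-Reasoning

noDescent⇒id : ∀ {m} (π : Permutation′ (suc m)) →
  (∀ (j : Fin m) → toℕ (π ⟨$⟩ˡ inject₁ j) < toℕ (π ⟨$⟩ˡ Fin.suc j)) → ∀ x → π ⟨$⟩ʳ x ≡ x
noDescent⇒id {m} π ascending x = trans (sym (π⁻¹≗id (π ⟨$⟩ʳ x))) (inverseˡ π)
  where
  ≤π⁻¹ : ∀ d (i : Fin (suc m)) → toℕ i ≡ d → d ≤ toℕ (π ⟨$⟩ˡ i)
  ≤π⁻¹ zero i _ = z≤n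
  ≤π⁻¹ (suc d) (Fin.suc i) eq =
    ℕP.≤-trans (s≤s (≤π⁻¹ d (inject₁ i) (trans (FinP.toℕ-inject₁ i) (ℕP.suc-injective eq)))) (ascending i)
  π⁻¹≗id : ∀ i → π ⟨$⟩ˡ i ≡ i
  π⁻¹≗id i = sym (FinP.toℕ-injective
    (∑-tight toℕ (toℕ ∘ (π ⟨$⟩ˡ_)) (λ i → ≤π⁻¹ (toℕ i) i refl) (∑-permute toℕ (Perm.flip π)) i))

-- Bubble sort: each step removes a descent of the inverse and exactly one inversion.
wordWithin : ∀ {m} fuel (π : Permutation′ (suc m)) → inversions (π ⟨$⟩ʳ_) ≤ fuel →
  Σ (List (Fin m)) λ ws → Represents ws (π ⟨$⟩ʳ_) × length ws ≤ inversions (π ⟨$⟩ʳ_)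
wordWithin {m} fuel π bound with FinP.any? (λ j → toℕ (π ⟨$⟩ˡ Fin.suc j) ℕP.<? toℕ (π ⟨$⟩ˡ inject₁ j))
... | no noDescent = List.[] , (λ x → sym (noDescent⇒id π ascending x)) , z≤n
  where
  ascending : ∀ j → toℕ (π ⟨$⟩ˡ inject₁ j) < toℕ (π ⟨$⟩ˡ Fin.suc j)
  ascending j with ascent-or-descent π j
  ... | inj₁ lt = lt
  ... | inj₂ gt = ⊥-elim (noDescent (j , gt))
... | yes (j , descent) = step fuel bound
  where
  π′ : Permutation′ (suc m)
  π′ = π ∘ₚ transpose (inject₁ j) (Fin.suc j)
  drop : inversions (π ⟨$⟩ʳ_) ≡ suc (inversions (π′ ⟨$⟩ʳ_))
  drop = inversions-descent π j (π-at-j π j) (π-at-suc-j π j) descent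
  step : ∀ fuel → inversions (π ⟨$⟩ʳ_) ≤ fuel →
    Σ (List (Fin m)) λ ws → Represents ws (π ⟨$⟩ʳ_) × length ws ≤ inversions (π ⟨$⟩ʳ_)
  step zero bound = ⊥-elim (ℕP.<⇒≱ (subst (0 <_) (sym drop) (s≤s z≤n)) bound)
  step (suc fuel) bound with wordWithin fuel π′ (ℕP.≤-pred (subst (_≤ suc fuel) drop bound))
  ... | γ , rep , len = j List.∷ γ , (λ x → trans (cong (sRefl j) (rep x)) (sRefl-involutive j (π ⟨$⟩ʳ x))) ,
                        ℕP.≤-trans (s≤s len) (ℕP.≤-reflexive (sym drop))

shortWord : ∀ {m} (π : Permutation′ (suc m)) →
  Σ (List (Fin m)) λ ws → Represents ws (π ⟨$⟩ʳ_) × length ws ≤ inversions (π ⟨$⟩ʳ_)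
shortWord π = wordWithin _ π ℕP.≤-refl

-- Every word has at least as many letters as inversions, so the bubble-sort word is reduced.
reducedWord : ∀ {m} (π : Permutation′ (suc m)) → Σ (List (Fin m)) λ ws → Reduced ws (π ⟨$⟩ʳ_)
reducedWord π with shortWord π
... | ws , rep , len = ws , rep , λ vs shorter repᵥ →
  ℕP.<⇒≱ shorter
    (ℕP.≤-trans len (ℕP.≤-trans (ℕP.≤-reflexive (sym (inversions-cong repᵥ))) (inversions≤length vs)))

-- The support of a permutation

Mixes : ∀ {m} → ℕ → (Fin m → Fin m) → Set
Mixes k u = ∃ λ i → k ≤ toℕ i × toℕ (u i) < k

mixes? : ∀ {m} k (u : Fin m → Fin m) → Dec (Mixes k u)
mixes? k u = FinP.any? (λ i → k ℕP.≤? toℕ i ×-dec toℕ (u i) ℕP.<? k)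

prod-preserves-≥ : ∀ {m} k (α : List (Gen m)) → All (λ j → genIndex j ≢ k) α → ∀ x →
  (k ≤ toℕ (prod α x) → k ≤ toℕ x) × (k ≤ toℕ x → k ≤ toℕ (prod α x))
prod-preserves-≥ k List.[] _ x = id , id
prod-preserves-≥ {suc m} k (j List.∷ α) (j≢k All.∷ α≢k) x =
  (λ k≤ → proj₁ rest (swapℕ-≤ (toℕ j) _ k j≢k (subst (k ≤_) (toℕ-sRefl j (prod α x)) k≤))) ,
  (λ k≤ → subst (k ≤_) (sym (toℕ-sRefl j (prod α x))) (≤-swapℕ (toℕ j) _ k j≢k (proj₂ rest k≤)))
  where rest = prod-preserves-≥ k α α≢k x

≥-invariant-reflected : ∀ {m} (π : Permutation′ m) k → (∀ i → k ≤ toℕ i → k ≤ toℕ (π ⟨$⟩ʳ i)) →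
  ∀ i → k ≤ toℕ (π ⟨$⟩ʳ i) → k ≤ toℕ i
≥-invariant-reflected π k invariant i k≤πi =
  []-pos (k ℕP.≤? toℕ i) (ℕP.≤-reflexive (sym (trans (same i) ([]-yes (k ℕP.≤? toℕ (π ⟨$⟩ʳ i)) k≤πi))))
  where
  pointwise : ∀ i → [ k ℕP.≤? toℕ i ] ≤ [ k ℕP.≤? toℕ (π ⟨$⟩ʳ i) ]
  pointwise i with k ℕP.≤? toℕ i
  ... | yes k≤i = ℕP.≤-reflexive (sym ([]-yes (k ℕP.≤? toℕ (π ⟨$⟩ʳ i)) (invariant i k≤i)))
  ... | no _ = z≤n
  same : ∀ i → [ k ℕP.≤? toℕ i ] ≡ [ k ℕP.≤? toℕ (π ⟨$⟩ʳ i) ]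
  same = ∑-tight _ _ pointwise (∑-permute (λ x → [ k ℕP.≤? toℕ x ]) π)

firstOccurrence : ∀ {a p} {A : Set a} {P : Pred A p} (P? : Decidable P) {xs : List A} →
  Any P xs → FirstView (λ x → ¬ P x) P xs
firstOccurrence P? any = toView (¬All⇒First (¬? ∘ P?) (decidable-stable (P? _)) (λ all → All¬⇒¬Any all any))

-- Write the reduced word as α s_k β with s_k ∉ α. Then V = s_k β also fixes {k, k + 1, …} setwise,
-- so s_k adds an inversion to V, and α followed by a word for V of length inversions V is shorter.
invariant⇒¬InSupp : ∀ {m} (u : Permutation′ (suc m)) k → (∀ i → k ≤ toℕ i → k ≤ toℕ (u ⟨$⟩ʳ i)) →
  ¬ InSupp k (u ⟨$⟩ʳ_)
invariant⇒¬InSupp {m} u k invariant (ws , (rep , minimal) , any)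
  with firstOccurrence (λ j → genIndex j ℕP.≟ k) any
... | _++_∷_ {α} {j} α≢k refl β = minimal (α ++ γ) shorter repγ
  where
  V : Permutation′ (suc m)
  V = permOfWord (j List.∷ β)
  u≗αV : ∀ x → u ⟨$⟩ʳ x ≡ prod α (V ⟨$⟩ʳ x)
  u≗αV x = trans (sym (rep x))
    (trans (prod-++ α (j List.∷ β) x) (cong (prod α) (sym (permOfWord-prod (j List.∷ β) x))))
  V-invariant : ∀ i → suc (toℕ j) ≤ toℕ i → suc (toℕ j) ≤ toℕ (V ⟨$⟩ʳ i)
  V-invariant i k≤i =
    proj₁ (prod-preserves-≥ _ α α≢k (V ⟨$⟩ʳ i)) (subst (λ y → _ ≤ toℕ y) (u≗αV i) (invariant i k≤i))
  a b : Fin (suc m)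
  a = V ⟨$⟩ˡ inject₁ j
  b = V ⟨$⟩ˡ Fin.suc j
  a<b : toℕ a < toℕ b
  a<b = ℕP.<-≤-trans
    (ℕP.≰⇒> (λ k≤a → ℕP.<-irrefl (sym (π-at-j V j)) (V-invariant a k≤a)))
    (≥-invariant-reflected V _ V-invariant b (ℕP.≤-reflexive (sym (π-at-suc-j V j))))
  β-inversions : inversions (prod β) ≡ suc (inversions (V ⟨$⟩ʳ_))
  β-inversions = trans (inversions-cong (λ x → trans (sym (sRefl-involutive j (prod β x)))
                                                    (cong (sRefl j) (sym (permOfWord-prod (j List.∷ β) x)))))
                       (inversions-ascent V j (π-at-j V j) (π-at-suc-j V j) a<b)
  γ : List (Fin m)
  γ = proj₁ (shortWord V)
  repγ : Represents (α ++ γ) (u ⟨$⟩ʳ_)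
  repγ x = trans (prod-++ α γ x) (trans (cong (prod α) (proj₁ (proj₂ (shortWord V)) x)) (sym (u≗αV x)))
  γ<jβ : length γ < length (j List.∷ β)
  γ<jβ = s≤s (ℕP.≤-trans (proj₂ (proj₂ (shortWord V)))
           (ℕP.≤-pred (ℕP.≤-trans (ℕP.≤-reflexive (sym β-inversions))
                                  (ℕP.≤-trans (inversions≤length β) (ℕP.n≤1+n _)))))
  shorter : length (α ++ γ) < length (α ++ j List.∷ β)
  shorter = subst₂ _<_ (sym (ListP.length-++ α)) (sym (ListP.length-++ α)) (ℕP.+-monoʳ-< (length α) γ<jβ)

inSupp⇔mixes : ∀ {m} (u : Permutation′ m) k → InSupp k (u ⟨$⟩ʳ_) ⇔ Mixes k (u ⟨$⟩ʳ_)
inSupp⇔mixes {zero} u k = mk⇔ (λ { (List.[] , _ , ()) }) (λ { (() , _) })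
inSupp⇔mixes {suc m} u k = mk⇔ inSupp⇒mixes mixes⇒inSupp
  where
  inSupp⇒mixes : InSupp k (u ⟨$⟩ʳ_) → Mixes k (u ⟨$⟩ʳ_)
  inSupp⇒mixes s with mixes? k (u ⟨$⟩ʳ_)
  ... | yes mixes = mixes
  ... | no ¬mixes = ⊥-elim (invariant⇒¬InSupp u k (λ i k≤i → ℕP.≮⇒≥ (λ lt → ¬mixes (i , k≤i , lt))) s)
  mixes⇒inSupp : Mixes k (u ⟨$⟩ʳ_) → InSupp k (u ⟨$⟩ʳ_)
  mixes⇒inSupp (i , k≤i , ui<k) with reducedWord u
  ... | ws , reduced with Any.any? (λ j → genIndex j ℕP.≟ k) ws
  ...   | yes any = ws , reduced , any
  ...   | no ¬any = ⊥-elim (ℕP.<⇒≱ ui<k (subst (λ y → k ≤ toℕ y) (proj₁ reduced i)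
                       (proj₂ (prod-preserves-≥ k ws (¬Any⇒All¬ ws ¬any) i) k≤i)))

toℕ-punchIn≥ : ∀ {m} (i : Fin (suc m)) (x : Fin m) → toℕ i ≤ toℕ x → toℕ (Fin.punchIn i x) ≡ suc (toℕ x)
toℕ-punchIn≥ Fin.zero x _ = refl
toℕ-punchIn≥ (Fin.suc i) (Fin.suc x) i≤x = cong suc (toℕ-punchIn≥ i x (ℕP.≤-pred i≤x))

toℕ-punchOut< : ∀ {m} {i j : Fin (suc m)} (i≢j : i ≢ j) → toℕ j < toℕ i → toℕ (Fin.punchOut i≢j) ≡ toℕ j
toℕ-punchOut< {suc m} {Fin.suc i} {Fin.zero} _ _ = refl
toℕ-punchOut< {suc m} {Fin.suc i} {Fin.suc j} i≢j j<i = cong suc (toℕ-punchOut< (i≢j ∘ cong Fin.suc) (ℕP.≤-pred j<i))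

toℕ-punchOut> : ∀ {m} {i j : Fin (suc m)} (i≢j : i ≢ j) → toℕ i < toℕ j → suc (toℕ (Fin.punchOut i≢j)) ≡ toℕ j
toℕ-punchOut> {m} {Fin.zero} {Fin.suc j} _ _ = refl
toℕ-punchOut> {suc m} {Fin.suc i} {Fin.suc j} i≢j i<j = cong suc (toℕ-punchOut> (i≢j ∘ cong Fin.suc) (ℕP.≤-pred i<j))

crossings-arithmetic : ∀ lb sb la r → (1 ≤ lb → r ≡ 0) → (2 ≤ la → sb ≡ 0) → (1 ≤ la → sb + r ≤ 1) →
  (lb + sb) ⊓ (la + lb ∸ r) ≡ lb + la * sb
crossings-arithmetic zero sb zero r _ _ _ rewrite ℕP.0∸n≡0 r = ℕP.⊓-zeroʳ sb
crossings-arithmetic (suc lb) sb zero r r≡0 _ _ rewrite r≡0 (s≤s z≤n) =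
  trans (ℕP.m≥n⇒m⊓n≡n (ℕP.m≤m+n (suc lb) sb)) (sym (ℕP.+-identityʳ (suc lb)))
crossings-arithmetic lb zero 1 zero _ _ _ = ℕP.m≤n⇒m⊓n≡m (ℕP.≤-trans (ℕP.≤-reflexive (ℕP.+-identityʳ lb)) (ℕP.n≤1+n lb))
crossings-arithmetic lb 1 1 zero _ _ _ rewrite ℕP.+-comm lb 1 = ℕP.⊓-idem (suc lb)
crossings-arithmetic zero zero 1 (suc r) _ _ _ = refl
crossings-arithmetic (suc lb) zero 1 (suc r) r≡0 _ _ with r≡0 (s≤s z≤n)
... | ()
crossings-arithmetic lb 1 1 (suc r) _ _ ≤1 with ≤1 (s≤s z≤n)
... | s≤s ()
crossings-arithmetic lb (suc (suc sb)) 1 r _ _ ≤1 with ≤1 (s≤s z≤n)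
... | s≤s ()
crossings-arithmetic lb sb (suc (suc la)) r r≡0 sb≡0 _ rewrite sb≡0 (s≤s (s≤s z≤n)) | ℕP.*-zeroʳ la = no-sb lb r≡0
  where
  no-sb : ∀ lb → (1 ≤ lb → r ≡ 0) → (lb + 0) ⊓ (suc (suc la) + lb ∸ r) ≡ lb + 0
  no-sb zero _ = refl
  no-sb (suc lb) r≡0 rewrite r≡0 (s≤s z≤n) =
    ℕP.m≤n⇒m⊓n≡m (ℕP.≤-trans (ℕP.≤-reflexive (ℕP.+-identityʳ (suc lb))) (ℕP.m≤n+m (suc lb) (suc (suc la))))

+≤1 : ∀ a b → ¬ (2 ≤ a) → (1 ≤ a → 1 ≤ b → ⊥) → ¬ (2 ≤ b) → a + b ≤ 1
+≤1 zero b _ _ b≱2 = ℕP.≤-pred (ℕP.≰⇒> b≱2)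
+≤1 1 zero _ _ _ = s≤s z≤n
+≤1 1 (suc b) _ notBoth _ = ⊥-elim (notBoth (s≤s z≤n) (s≤s z≤n))
+≤1 (suc (suc a)) b a≱2 _ _ = ⊥-elim (a≱2 (s≤s (s≤s z≤n)))

∸-cancel-shared : ∀ la sa lb sb r → suc (la + sa) + (lb + sb) ∸ suc (sa + (sb + r)) ≡ la + lb ∸ r
∸-cancel-shared la sa lb sb r =
  trans (cong₂ _∸_ (regroup₁ la sa lb sb) (regroup₂ sa sb r)) (ℕP.[m+n]∸[m+o]≡n∸o (sa + sb) (la + lb) r)
  where
  regroup₁ : ∀ la sa lb sb → la + sa + (lb + sb) ≡ sa + sb + (la + lb)
  regroup₁ = solve-∀
  regroup₂ : ∀ sa sb r → sa + (sb + r) ≡ sa + sb + r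
  regroup₂ = solve-∀

-- Counting for a fixed permutation w

module _ {n} (w : Permutation′ (suc n)) where

  val : Fin (suc n) → ℕ
  val i = toℕ (w ⟨$⟩ʳ i)

  top : Fin (suc n)
  top = w ⟨$⟩ˡ Fin.fromℕ n

  T : ℕ
  T = toℕ top

  w-top : w ⟨$⟩ʳ top ≡ Fin.fromℕ n
  w-top = inverseʳ w

  val-top : val top ≡ n
  val-top = trans (cong toℕ w-top) (FinP.toℕ-fromℕ n)

  val≤n : ∀ i → val i ≤ n
  val≤n i = FinP.toℕ≤pred[n] (w ⟨$⟩ʳ i)

  val-injective : ∀ {i j} → val i ≡ val j → i ≡ j
  val-injective = ⟨$⟩ʳ-injective w ∘ FinP.toℕ-injective

  val<n : ∀ {i} → i ≢ top → val i < n
  val<n {i} i≢top with ℕP.m≤n⇒m<n∨m≡n (val≤n i)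
  ... | inj₁ lt = lt
  ... | inj₂ eq = ⊥-elim (i≢top (val-injective (trans eq (sym val-top))))

  val<val-top : ∀ {i} → i ≢ top → val i < val top
  val<val-top {i} i≢top = subst (val i <_) (sym val-top) (val<n i≢top)

  after-top⇒≢top : ∀ {i} → T < toℕ i → i ≢ top
  after-top⇒≢top T<i = FinP.<⇒≢ T<i ∘ sym

  before-top⇒≢top : ∀ {i} → toℕ i < T → i ≢ top
  before-top⇒≢top = FinP.<⇒≢

  val-compare : ∀ i j → i ≢ j → val i < val j ⊎ val j < val i
  val-compare i j i≢j with ℕP.<-cmp (val i) (val j)
  ... | tri< lt _ _ = inj₁ lt
  ... | tri≈ _ eq _ = ⊥-elim (i≢j (val-injective eq))
  ... | tri> _ _ gt = inj₂ gt

  largerBetween? : (j i : Fin (suc n)) → Dec (T < toℕ i × toℕ i < toℕ j × val j < val i)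
  largerBetween? j i = T ℕP.<? toℕ i ×-dec toℕ i ℕP.<? toℕ j ×-dec val j ℕP.<? val i

  smallerBetween? : (j i : Fin (suc n)) → Dec (T < toℕ i × toℕ i < toℕ j × val i < val j)
  smallerBetween? j i = T ℕP.<? toℕ i ×-dec toℕ i ℕP.<? toℕ j ×-dec val i ℕP.<? val j

  largerBefore? : (j i : Fin (suc n)) → Dec (toℕ i < T × val j < val i)
  largerBefore? j i = toℕ i ℕP.<? T ×-dec val j ℕP.<? val i

  smallerBefore? : (j i : Fin (suc n)) → Dec (toℕ i < T × val i < val j)
  smallerBefore? j i = toℕ i ℕP.<? T ×-dec val i ℕP.<? val j

  smallerAfter? : (j i : Fin (suc n)) → Dec (toℕ j < toℕ i × val i < val j)
  smallerAfter? j i = toℕ j ℕP.<? toℕ i ×-dec val i ℕP.<? val j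

  -- "Before", "between" and "after" refer to the positions top and j.
  largerBetween smallerBetween largerBefore smallerBefore smallerAfter : Fin (suc n) → ℕ
  largerBetween j = ∑ λ i → [ largerBetween? j i ]
  smallerBetween j = ∑ λ i → [ smallerBetween? j i ]
  largerBefore j = ∑ λ i → [ largerBefore? j i ]
  smallerBefore j = ∑ λ i → [ smallerBefore? j i ]
  smallerAfter j = ∑ λ i → [ smallerAfter? j i ]

  occurrence321⇔ : ∀ a b c → NOcc p321 w (a ∷ b ∷ c ∷ []) ⇔ (a ≡ top × T < toℕ b × toℕ b < toℕ c × val c < val b)
  occurrence321⇔ a b c = mk⇔ to from
    where
    sorted : Sorts p321 (2F ∷ 1F ∷ 0F ∷ [])
    sorted = sorts p321 (2F ∷ 1F ∷ 0F ∷ [])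
    to : NOcc p321 w (a ∷ b ∷ c ∷ []) → a ≡ top × T < toℕ b × toℕ b < toℕ c × val c < val b
    to occ with nOcc⇒chains sorted w (a ∷ b ∷ c ∷ []) occ | nOcc-top sorted w (a ∷ b ∷ c ∷ []) occ
    ... | a<b ∷ b<c ∷ [-] , c<b ∷ _ ∷ [-] | wa≡N with ⟨$⟩ʳ-injective w (trans wa≡N (sym w-top))
    ...   | refl = refl , a<b , b<c , c<b
    from : a ≡ top × T < toℕ b × toℕ b < toℕ c × val c < val b → NOcc p321 w (a ∷ b ∷ c ∷ [])
    from (refl , T<b , b<c , c<b) = nOcc-by-sorting sorted w _ (T<b ∷ b<c ∷ [-])
      (c<b ∷ val<val-top (after-top⇒≢top T<b) ∷ [-]) (0F , w-top)

  occurrence3412⇔ : ∀ a b c d → NOcc p3412 w (a ∷ b ∷ c ∷ d ∷ []) ⇔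
    (b ≡ top × (toℕ a < T × val d < val a) × (T < toℕ c × toℕ c < toℕ d × val c < val d))
  occurrence3412⇔ a b c d = mk⇔ to from
    where
    sorted : Sorts p3412 (2F ∷ 3F ∷ 0F ∷ 1F ∷ [])
    sorted = sorts p3412 (2F ∷ 3F ∷ 0F ∷ 1F ∷ [])
    to : NOcc p3412 w (a ∷ b ∷ c ∷ d ∷ []) →
      b ≡ top × (toℕ a < T × val d < val a) × (T < toℕ c × toℕ c < toℕ d × val c < val d)
    to occ with nOcc⇒chains sorted w (a ∷ b ∷ c ∷ d ∷ []) occ | nOcc-top sorted w (a ∷ b ∷ c ∷ d ∷ []) occ
    ... | a<b ∷ b<c ∷ c<d ∷ [-] , c<d′ ∷ d<a ∷ _ ∷ [-] | wb≡N with ⟨$⟩ʳ-injective w (trans wb≡N (sym w-top))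
    ...   | refl = refl , (a<b , d<a) , (b<c , c<d , c<d′)
    from : b ≡ top × (toℕ a < T × val d < val a) × (T < toℕ c × toℕ c < toℕ d × val c < val d) →
      NOcc p3412 w (a ∷ b ∷ c ∷ d ∷ [])
    from (refl , (a<T , d<a) , (T<c , c<d , c<d′)) = nOcc-by-sorting sorted w _ (a<T ∷ T<c ∷ c<d ∷ [-])
      (c<d′ ∷ d<a ∷ val<val-top (before-top⇒≢top a<T) ∷ [-]) (1F , w-top)

  count321≡∑largerBetween : countNOcc p321 w ≡ ∑ largerBetween
  count321≡∑largerBetween = begin
    countNOcc p321 w
      ≡⟨ countNOcc-∑₃ p321 w ⟩
    (∑ λ a → ∑ λ b → ∑ λ c → [ NOcc? p321 w (a ∷ b ∷ c ∷ []) ])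
      ≡⟨ ∑-cong (λ a → ∑-cong λ b → ∑-cong λ c →
           trans ([]-⇔ (NOcc? p321 w (a ∷ b ∷ c ∷ [])) ((a Fin.≟ top) ×-dec largerBetween? c b)
                        (Equivalence.to (occurrence321⇔ a b c)) (Equivalence.from (occurrence321⇔ a b c)))
                 ([]-× (a Fin.≟ top) (largerBetween? c b) _)) ⟩
    (∑ λ a → ∑ λ b → ∑ λ c → [ a Fin.≟ top ] * [ largerBetween? c b ])
      ≡⟨ ∑-cong (λ a → trans (∑-cong λ b → ∑-*ˡ [ a Fin.≟ top ] _) (∑-*ˡ [ a Fin.≟ top ] _)) ⟩
    (∑ λ a → [ a Fin.≟ top ] * ∑ λ b → ∑ λ c → [ largerBetween? c b ])
      ≡⟨ ∑-select top _ ⟩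
    (∑ λ b → ∑ λ c → [ largerBetween? c b ])
      ≡⟨ ∑-comm (λ b c → [ largerBetween? c b ]) ⟩
    ∑ largerBetween ∎
    where open ≡-Reasoning

  count3412≡∑largerBefore*smallerBetween : countNOcc p3412 w ≡ ∑ (λ d → largerBefore d * smallerBetween d)
  count3412≡∑largerBefore*smallerBetween = begin
    countNOcc p3412 w
      ≡⟨ countNOcc-∑₄ p3412 w ⟩
    (∑ λ a → ∑ λ b → ∑ λ c → ∑ λ d → [ NOcc? p3412 w (a ∷ b ∷ c ∷ d ∷ []) ])
      ≡⟨ ∑-cong (λ a → ∑-cong λ b → ∑-cong λ c → ∑-cong λ d →
           trans ([]-⇔ (NOcc? p3412 w (a ∷ b ∷ c ∷ d ∷ [])) ((b Fin.≟ top) ×-dec (largerBefore? d a ×-dec smallerBetween? d c))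
                        (Equivalence.to (occurrence3412⇔ a b c d)) (Equivalence.from (occurrence3412⇔ a b c d)))
           (trans ([]-× (b Fin.≟ top) (largerBefore? d a ×-dec smallerBetween? d c) _)
                  (cong ([ b Fin.≟ top ] *_) ([]-× (largerBefore? d a) (smallerBetween? d c) _)))) ⟩
    (∑ λ a → ∑ λ b → ∑ λ c → ∑ λ d → [ b Fin.≟ top ] * ([ largerBefore? d a ] * [ smallerBetween? d c ]))
      ≡⟨ ∑-cong (λ a → ∑-cong λ b → trans (∑-cong λ c → ∑-*ˡ [ b Fin.≟ top ] _) (∑-*ˡ [ b Fin.≟ top ] _)) ⟩
    (∑ λ a → ∑ λ b → [ b Fin.≟ top ] * ∑ λ c → ∑ λ d → [ largerBefore? d a ] * [ smallerBetween? d c ])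
      ≡⟨ ∑-cong (λ a → ∑-select top _) ⟩
    (∑ λ a → ∑ λ c → ∑ λ d → [ largerBefore? d a ] * [ smallerBetween? d c ])
      ≡⟨ ∑-cong (λ a → ∑-comm (λ c d → [ largerBefore? d a ] * [ smallerBetween? d c ])) ⟩
    (∑ λ a → ∑ λ d → ∑ λ c → [ largerBefore? d a ] * [ smallerBetween? d c ])
      ≡⟨ ∑-comm (λ a d → ∑ λ c → [ largerBefore? d a ] * [ smallerBetween? d c ]) ⟩
    (∑ λ d → ∑ λ a → ∑ λ c → [ largerBefore? d a ] * [ smallerBetween? d c ])
      ≡⟨ ∑-cong (λ d → trans (∑-cong λ a → ∑-*ˡ [ largerBefore? d a ] _) (∑-*ʳ (smallerBetween d) _)) ⟩
    ∑ (λ d → largerBefore d * smallerBetween d) ∎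
    where open ≡-Reasoning

  crossing? : (j k : Fin (suc n)) → Dec (T < toℕ k × toℕ k < toℕ j × val j < toℕ k)
  crossing? j k = T ℕP.<? toℕ k ×-dec toℕ k ℕP.<? toℕ j ×-dec val j ℕP.<? toℕ k

  crossings : Fin (suc n) → ℕ
  crossings j = ∑ λ k → [ crossing? j k ]

  crossings-formula : ∀ j → crossings j ≡ toℕ j ∸ suc (T ⊔ val j)
  crossings-formula j = trans
    (∑-cong λ k → []-⇔ (crossing? j k) (T ⊔ val j ℕP.<? toℕ k ×-dec toℕ k ℕP.<? toℕ j)
       (λ (T<k , k<j , j<k) → ℕP.⊔-pres-<m T<k j<k , k<j)
       (λ (max<k , k<j) → ℕP.m⊔n<o⇒m<o T _ max<k , k<j , ℕP.m⊔n<o⇒n<o T _ max<k))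
    (count-between (T ⊔ val j) (toℕ j) (FinP.toℕ≤n j))

  crossings-before-top : ∀ j → toℕ j ≤ T → crossings j ≡ largerBetween j + largerBefore j * smallerBetween j
  crossings-before-top j j≤T = trans (crossings-formula j)
    (trans (ℕP.m≤n⇒m∸n≡0 (ℕP.≤-trans j≤T (ℕP.≤-trans (ℕP.m≤m⊔n T (val j)) (ℕP.n≤1+n _))))
    (sym (trans (cong₂ (λ lb sb → lb + largerBefore j * sb) none none) (ℕP.*-zeroʳ (largerBefore j)))))
    where
    none : ∀ {X : Fin (suc n) → Set} {d : ∀ i → Dec (T < toℕ i × toℕ i < toℕ j × X i)} →
      ∑ (λ i → [ d i ]) ≡ 0
    none {d = d} = count-none d (λ i (T<i , i<j , _) → ℕP.<⇒≱ (ℕP.<-trans T<i i<j) j≤T)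

  module _ (j : Fin (suc n)) (T<j : T < toℕ j) where

    between-split : toℕ j ∸ suc T ≡ largerBetween j + smallerBetween j
    between-split = trans (sym (count-between T (toℕ j) (FinP.toℕ≤n j)))
      (trans (∑-cong λ i → []-⊎ (T ℕP.<? toℕ i ×-dec toℕ i ℕP.<? toℕ j) (largerBetween? j i) (smallerBetween? j i)
                (λ (T<i , i<j) → Sum.map (λ gt → T<i , i<j , gt) (λ lt → T<i , i<j , lt)
                                    (val-compare j i (FinP.<⇒≢ i<j ∘ sym)))
                (λ (T<i , i<j , _) → T<i , i<j) (λ (T<i , i<j , _) → T<i , i<j)
                (λ (_ , _ , gt) (_ , _ , lt) → ℕP.<-asym gt lt))
             (∑-+ _ _))

    before-split : T ≡ largerBefore j + smallerBefore j
    before-split = trans (sym (count-< T (ℕP.≤-trans (ℕP.<⇒≤ T<j) (FinP.toℕ≤n j))))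
      (trans (∑-cong λ i → []-⊎ (toℕ i ℕP.<? T) (largerBefore? j i) (smallerBefore? j i)
                (λ i<T → Sum.map (i<T ,_) (i<T ,_) (val-compare j i (FinP.<⇒≢ (ℕP.<-trans i<T T<j) ∘ sym)))
                proj₁ proj₁ (λ (_ , gt) (_ , lt) → ℕP.<-asym gt lt))
             (∑-+ _ _))

    below-split : val j ≡ smallerBefore j + (smallerBetween j + smallerAfter j)
    below-split = begin
      val j
        ≡⟨ count-< (val j) (FinP.toℕ≤n (w ⟨$⟩ʳ j)) ⟨
      ∑ (λ x → [ toℕ x ℕP.<? val j ])
        ≡⟨ ∑-permute (λ x → [ toℕ x ℕP.<? val j ]) w ⟩
      ∑ (λ i → [ val i ℕP.<? val j ])
        ≡⟨ trans (∑-cong λ i → []-⊎ (val i ℕP.<? val j) (smallerBefore? j i) (T ℕP.<? toℕ i ×-dec val i ℕP.<? val j)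
                   (λ lt → Sum.map (_, lt) (_, lt) (before-or-after i lt)) proj₂ proj₂
                   (λ (i<T , _) (T<i , _) → ℕP.<-asym i<T T<i))
                 (∑-+ _ _) ⟩
      smallerBefore j + ∑ (λ i → [ T ℕP.<? toℕ i ×-dec val i ℕP.<? val j ])
        ≡⟨ cong (smallerBefore j +_) (trans (∑-cong λ i →
              []-⊎ (T ℕP.<? toℕ i ×-dec val i ℕP.<? val j) (smallerBetween? j i) (smallerAfter? j i)
                (λ (T<i , lt) → between-or-after i T<i lt)
                (λ (T<i , _ , lt) → T<i , lt) (λ (j<i , lt) → ℕP.<-trans T<j j<i , lt)
                (λ (_ , i<j , _) (j<i , _) → ℕP.<-asym i<j j<i))
              (∑-+ _ _)) ⟩
      smallerBefore j + (smallerBetween j + smallerAfter j) ∎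
      where
      open ≡-Reasoning
      before-or-after : ∀ i → val i < val j → toℕ i < T ⊎ T < toℕ i
      before-or-after i lt with ℕP.<-cmp (toℕ i) T
      ... | tri< i<T _ _ = inj₁ i<T
      ... | tri≈ _ eq _ = ⊥-elim (ℕP.<-asym lt (subst (λ x → val j < val x) (sym (FinP.toℕ-injective eq))
                             (val<val-top (after-top⇒≢top T<j))))
      ... | tri> _ _ T<i = inj₂ T<i
      between-or-after : ∀ i → T < toℕ i → val i < val j →
        (T < toℕ i × toℕ i < toℕ j × val i < val j) ⊎ (toℕ j < toℕ i × val i < val j)
      between-or-after i T<i lt with ℕP.<-cmp (toℕ i) (toℕ j)
      ... | tri< i<j _ _ = inj₁ (T<i , i<j , lt)
      ... | tri≈ _ eq _ = ⊥-elim (ℕP.<-irrefl (cong val (FinP.toℕ-injective eq)) lt)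
      ... | tri> _ _ j<i = inj₂ (j<i , lt)

    crossings-after-top :
      (1 ≤ largerBetween j → smallerAfter j ≡ 0) → (2 ≤ largerBefore j → smallerBetween j ≡ 0) →
      (1 ≤ largerBefore j → smallerBetween j + smallerAfter j ≤ 1) →
      crossings j ≡ largerBetween j + largerBefore j * smallerBetween j
    crossings-after-top c₁ c₂ c₃ = begin
      crossings j
        ≡⟨ crossings-formula j ⟩
      toℕ j ∸ suc (T ⊔ val j)
        ≡⟨ ℕP.∸-distribˡ-⊔-⊓ (toℕ j) (suc T) (suc (val j)) ⟩
      (toℕ j ∸ suc T) ⊓ (toℕ j ∸ suc (val j))
        ≡⟨ cong₂ _⊓_ between-split after-value ⟩
      (largerBetween j + smallerBetween j) ⊓ (largerBefore j + largerBetween j ∸ smallerAfter j)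
        ≡⟨ crossings-arithmetic _ _ _ _ c₁ c₂ c₃ ⟩
      largerBetween j + largerBefore j * smallerBetween j ∎
      where
      open ≡-Reasoning
      j≡ : toℕ j ≡ suc (largerBefore j + smallerBefore j) + (largerBetween j + smallerBetween j)
      j≡ = trans (sym (ℕP.m+[n∸m]≡n T<j)) (cong₂ (λ a b → suc a + b) before-split between-split)
      after-value : toℕ j ∸ suc (val j) ≡ largerBefore j + largerBetween j ∸ smallerAfter j
      after-value = trans (cong₂ (λ a b → a ∸ suc b) j≡ below-split)
        (∸-cancel-shared (largerBefore j) (smallerBefore j) (largerBetween j) (smallerBetween j) (smallerAfter j))

  atOrBeforeAbove? : (k i : Fin (suc n)) → Dec (toℕ i ≤ toℕ k × toℕ k ≤ val i × val i < n)
  atOrBeforeAbove? k i = toℕ i ℕP.≤? toℕ k ×-dec toℕ k ℕP.≤? val i ×-dec val i ℕP.<? n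

  afterBelow? : (k j : Fin (suc n)) → Dec (toℕ k < toℕ j × val j < toℕ k)
  afterBelow? k j = toℕ k ℕP.<? toℕ j ×-dec val j ℕP.<? toℕ k

  -- Count the letters with value < k by position, and the positions ≤ k by value; the top letter
  -- is one of the latter since T < k.
  balance : ∀ k → T < toℕ k → ∑ (λ i → [ atOrBeforeAbove? k i ]) ≡ ∑ (λ j → [ afterBelow? k j ])
  balance k T<k = ℕP.suc-injective (ℕP.+-cancelˡ-≡ X _ _
    (trans (sym positions≤k) (trans (cong suc values<k) (sym (ℕP.+-suc X _)))))
    where
    open ≡-Reasoning
    small? : (i : Fin (suc n)) → Dec (toℕ i ≤ toℕ k × val i < toℕ k)
    small? i = toℕ i ℕP.≤? toℕ k ×-dec val i ℕP.<? toℕ k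
    X = ∑ λ i → [ small? i ]
    values<k : toℕ k ≡ X + ∑ (λ j → [ afterBelow? k j ])
    values<k = begin
      toℕ k                                 ≡⟨ count-< (toℕ k) (FinP.toℕ≤n k) ⟨
      ∑ (λ x → [ toℕ x ℕP.<? toℕ k ])       ≡⟨ ∑-permute (λ x → [ toℕ x ℕP.<? toℕ k ]) w ⟩
      ∑ (λ i → [ val i ℕP.<? toℕ k ])       ≡⟨ ∑-cong (λ i → []-⊎ (val i ℕP.<? toℕ k) (small? i) (afterBelow? k i)
                                                 (λ lt → Sum.map (_, lt) (_, lt) (ℕP.≤-<-connex (toℕ i) (toℕ k)))
                                                 proj₂ proj₂ (λ (i≤k , _) (k<i , _) → ℕP.<⇒≱ k<i i≤k)) ⟩
      ∑ (λ i → [ small? i ] + [ afterBelow? k i ]) ≡⟨ ∑-+ _ _ ⟩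
      X + ∑ (λ j → [ afterBelow? k j ])     ∎
    large? : (i : Fin (suc n)) → Dec (toℕ i ≤ toℕ k × toℕ k ≤ val i)
    large? i = toℕ i ℕP.≤? toℕ k ×-dec toℕ k ℕP.≤? val i
    large-split : ∀ i → [ large? i ] ≡ [ i Fin.≟ top ] + [ atOrBeforeAbove? k i ]
    large-split i = []-⊎ (large? i) (i Fin.≟ top) (atOrBeforeAbove? k i)
      (λ (i≤k , k≤i) → Sum.map id (λ i≢top → i≤k , k≤i , val<n i≢top) (toSum (i Fin.≟ top)))
      (λ { refl → ℕP.<⇒≤ T<k , subst (toℕ k ≤_) (sym val-top) (FinP.toℕ≤pred[n] k) })
      (λ (i≤k , k≤i , _) → i≤k , k≤i)
      (λ { refl (_ , _ , top<n) → ℕP.<-irrefl val-top top<n })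
    positions≤k : suc (toℕ k) ≡ X + suc (∑ (λ i → [ atOrBeforeAbove? k i ]))
    positions≤k = begin
      suc (toℕ k)                              ≡⟨ count-< (suc (toℕ k)) (FinP.toℕ<n k) ⟨
      ∑ (λ i → [ toℕ i ℕP.<? suc (toℕ k) ])
        ≡⟨ ∑-cong (λ i → []-⊎ (toℕ i ℕP.<? suc (toℕ k)) (small? i) (large? i)
             (λ i<sk → Sum.map (ℕP.≤-pred i<sk ,_) (ℕP.≤-pred i<sk ,_) (ℕP.<-≤-connex (val i) (toℕ k)))
             (s≤s ∘ proj₁) (s≤s ∘ proj₁) (λ (_ , lt) (_ , ge) → ℕP.<⇒≱ lt ge)) ⟩
      ∑ (λ i → [ small? i ] + [ large? i ])     ≡⟨ ∑-+ _ _ ⟩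
      X + ∑ (λ i → [ large? i ])               ≡⟨ cong (X +_) (trans (∑-cong large-split) (∑-+ _ _)) ⟩
      X + (∑ (λ i → [ i Fin.≟ top ]) + ∑ (λ i → [ atOrBeforeAbove? k i ]))
                                               ≡⟨ cong (λ t → X + (t + ∑ (λ i → [ atOrBeforeAbove? k i ]))) (∑-indicator top) ⟩
      X + suc (∑ (λ i → [ atOrBeforeAbove? k i ])) ∎

  -- The characterisation of newrep(w) obtained from `inSupp⇔mixes`; positions and values are
  -- 0-based, so T + 1 = w⁻¹(N).
  InNewrep : ℕ → Set
  InNewrep k = T < k × ∃ λ j → k < toℕ j × val j < k

  inNewrep? : (k : Fin (suc n)) → Dec (InNewrep (toℕ k))
  inNewrep? k = T ℕP.<? toℕ k ×-dec FinP.any? (λ j → toℕ k ℕP.<? toℕ j ×-dec val j ℕP.<? toℕ k)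

  val-wbar : ∀ x → toℕ (wbar w ⟨$⟩ʳ x) ≡ val (Fin.punchIn top x)
  val-wbar x = toℕ-punchOut< _ (val<val-top (FinP.punchInᵢ≢i top x))

  newrep⇔inNewrep : ∀ k → NewRep w k ⇔ InNewrep k
  newrep⇔inNewrep k = mk⇔ to from
    where
    to : NewRep w k → InNewrep k
    to (inSupp , T<k) with Equivalence.to (inSupp⇔mixes (wbar w) k) inSupp
    ... | x , k≤x , x<k = T<k , Fin.punchIn top x ,
      subst (k <_) (sym (toℕ-punchIn≥ top x (ℕP.≤-trans (ℕP.<⇒≤ T<k) k≤x))) (s≤s k≤x) ,
      subst (_< k) (val-wbar x) x<k
    from : InNewrep k → NewRep w k
    from (T<k , j , k<j , j<k) = Equivalence.from (inSupp⇔mixes (wbar w) k) (x , k≤x , x<k) , T<k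
      where
      top≢j : top ≢ j
      top≢j = after-top⇒≢top (ℕP.<-trans T<k k<j) ∘ sym
      x : Fin n
      x = Fin.punchOut top≢j
      k≤x : k ≤ toℕ x
      k≤x = ℕP.≤-pred (subst (k <_) (sym (toℕ-punchOut> top≢j (ℕP.<-trans T<k k<j))) k<j)
      x<k : toℕ (wbar w ⟨$⟩ʳ x) < k
      x<k = subst (_< k) (sym (trans (val-wbar x) (cong val (FinP.punchIn-punchOut top≢j)))) j<k

  inNewrep-bounded : ∀ k → InNewrep k → k < suc n
  inNewrep-bounded k (_ , j , k<j , _) = ℕP.<-trans k<j (FinP.toℕ<n j)

  module _ (avoid : ∀ (k : ℕ) (p : Vec ℕ k) → Φ k p → AvoidsN p w) where

    excluded : ∀ {k pat} {σ : Vec (Fin k) k} → Φ k pat → Sorts pat σ → (is : Vec (Fin (suc n)) k) →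
      Linked Fin._<_ is → Linked Fin._<_ (Vec.map (λ a → w ⟨$⟩ʳ lookup is a) σ) → HasTopValue w is → ⊥
    excluded φ sorted is increasing chain topValue = avoid _ _ φ is (nOcc-by-sorting sorted w is increasing chain topValue)

    no4321 : ∀ {a b c} → T < toℕ a → toℕ a < toℕ b → toℕ b < toℕ c → val c < val b → val b < val a → ⊥
    no4321 {a} {b} {c} T<a a<b b<c c<b b<a =
      excluded φ4321 (sorts _ (3F ∷ 2F ∷ 1F ∷ 0F ∷ [])) (top ∷ a ∷ b ∷ c ∷ [])
        (T<a ∷ a<b ∷ b<c ∷ [-]) (c<b ∷ b<a ∷ val<val-top (after-top⇒≢top T<a) ∷ [-]) (0F , w-top)

    no34512 : ∀ {a₁ a₂ c d} → toℕ a₁ < toℕ a₂ → toℕ a₂ < T → T < toℕ c → toℕ c < toℕ d →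
      val c < val d → val d < val a₁ → val a₁ < val a₂ → ⊥
    no34512 {a₁} {a₂} {c} {d} a₁<a₂ a₂<T T<c c<d c<d′ d<a₁ a₁<a₂′ =
      excluded φ34512 (sorts _ (3F ∷ 4F ∷ 0F ∷ 1F ∷ 2F ∷ [])) (a₁ ∷ a₂ ∷ top ∷ c ∷ d ∷ [])
        (a₁<a₂ ∷ a₂<T ∷ T<c ∷ c<d ∷ [-]) (c<d′ ∷ d<a₁ ∷ a₁<a₂′ ∷ val<val-top (before-top⇒≢top a₂<T) ∷ [-]) (2F , w-top)

    no43512 : ∀ {a₁ a₂ c d} → toℕ a₁ < toℕ a₂ → toℕ a₂ < T → T < toℕ c → toℕ c < toℕ d →
      val c < val d → val d < val a₂ → val a₂ < val a₁ → ⊥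
    no43512 {a₁} {a₂} {c} {d} a₁<a₂ a₂<T T<c c<d c<d′ d<a₂ a₂<a₁ =
      excluded φ43512 (sorts _ (3F ∷ 4F ∷ 1F ∷ 0F ∷ 2F ∷ [])) (a₁ ∷ a₂ ∷ top ∷ c ∷ d ∷ [])
        (a₁<a₂ ∷ a₂<T ∷ T<c ∷ c<d ∷ [-]) (c<d′ ∷ d<a₂ ∷ a₂<a₁ ∷ val<val-top (before-top⇒≢top (ℕP.<-trans a₁<a₂ a₂<T)) ∷ [-])
        (2F , w-top)

    no45123 : ∀ {a c₁ c₂ d} → toℕ a < T → T < toℕ c₁ → toℕ c₁ < toℕ c₂ → toℕ c₂ < toℕ d →
      val c₁ < val c₂ → val c₂ < val d → val d < val a → ⊥
    no45123 {a} {c₁} {c₂} {d} a<T T<c₁ c₁<c₂ c₂<d c₁<c₂′ c₂<d′ d<a =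
      excluded φ45123 (sorts _ (2F ∷ 3F ∷ 4F ∷ 0F ∷ 1F ∷ [])) (a ∷ top ∷ c₁ ∷ c₂ ∷ d ∷ [])
        (a<T ∷ T<c₁ ∷ c₁<c₂ ∷ c₂<d ∷ [-]) (c₁<c₂′ ∷ c₂<d′ ∷ d<a ∷ val<val-top (before-top⇒≢top a<T) ∷ [-]) (1F , w-top)

    no45213 : ∀ {a c₁ c₂ d} → toℕ a < T → T < toℕ c₁ → toℕ c₁ < toℕ c₂ → toℕ c₂ < toℕ d →
      val c₂ < val c₁ → val c₁ < val d → val d < val a → ⊥
    no45213 {a} {c₁} {c₂} {d} a<T T<c₁ c₁<c₂ c₂<d c₂<c₁ c₁<d d<a =
      excluded φ45213 (sorts _ (3F ∷ 2F ∷ 4F ∷ 0F ∷ 1F ∷ [])) (a ∷ top ∷ c₁ ∷ c₂ ∷ d ∷ [])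
        (a<T ∷ T<c₁ ∷ c₁<c₂ ∷ c₂<d ∷ [-]) (c₂<c₁ ∷ c₁<d ∷ d<a ∷ val<val-top (before-top⇒≢top a<T) ∷ [-]) (1F , w-top)

    no45132 : ∀ {a c d l} → toℕ a < T → T < toℕ c → toℕ c < toℕ d → toℕ d < toℕ l →
      val c < val l → val l < val d → val d < val a → ⊥
    no45132 {a} {c} {d} {l} a<T T<c c<d d<l c<l l<d d<a =
      excluded φ45132 (sorts _ (2F ∷ 4F ∷ 3F ∷ 0F ∷ 1F ∷ [])) (a ∷ top ∷ c ∷ d ∷ l ∷ [])
        (a<T ∷ T<c ∷ c<d ∷ d<l ∷ [-]) (c<l ∷ l<d ∷ d<a ∷ val<val-top (before-top⇒≢top a<T) ∷ [-]) (1F , w-top)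

    no45231 : ∀ {a c d l} → toℕ a < T → T < toℕ c → toℕ c < toℕ d → toℕ d < toℕ l →
      val l < val c → val c < val d → val d < val a → ⊥
    no45231 {a} {c} {d} {l} a<T T<c c<d d<l l<c c<d′ d<a =
      excluded φ45231 (sorts _ (4F ∷ 2F ∷ 3F ∷ 0F ∷ 1F ∷ [])) (a ∷ top ∷ c ∷ d ∷ l ∷ [])
        (a<T ∷ T<c ∷ c<d ∷ d<l ∷ [-]) (l<c ∷ c<d′ ∷ d<a ∷ val<val-top (before-top⇒≢top a<T) ∷ [-]) (1F , w-top)

    no45312 : ∀ {a d l₁ l₂} → toℕ a < T → T < toℕ d → toℕ d < toℕ l₁ → toℕ l₁ < toℕ l₂ →
      val l₁ < val l₂ → val l₂ < val d → val d < val a → ⊥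
    no45312 {a} {d} {l₁} {l₂} a<T T<d d<l₁ l₁<l₂ l₁<l₂′ l₂<d d<a =
      excluded φ45312 (sorts _ (3F ∷ 4F ∷ 2F ∷ 0F ∷ 1F ∷ [])) (a ∷ top ∷ d ∷ l₁ ∷ l₂ ∷ [])
        (a<T ∷ T<d ∷ d<l₁ ∷ l₁<l₂ ∷ [-]) (l₁<l₂′ ∷ l₂<d ∷ d<a ∷ val<val-top (before-top⇒≢top a<T) ∷ [-]) (1F , w-top)

    no35412 : ∀ {y₁ y₂ j₁ j₂} → toℕ y₁ < T → T < toℕ y₂ → toℕ y₂ < toℕ j₁ → toℕ j₁ < toℕ j₂ →
      val j₁ < val j₂ → val j₂ < val y₁ → val y₁ < val y₂ → ⊥
    no35412 {y₁} {y₂} {j₁} {j₂} y₁<T T<y₂ y₂<j₁ j₁<j₂ j₁<j₂′ j₂<y₁ y₁<y₂ =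
      excluded φ35412 (sorts _ (3F ∷ 4F ∷ 0F ∷ 2F ∷ 1F ∷ [])) (y₁ ∷ top ∷ y₂ ∷ j₁ ∷ j₂ ∷ [])
        (y₁<T ∷ T<y₂ ∷ y₂<j₁ ∷ j₁<j₂ ∷ [-]) (j₁<j₂′ ∷ j₂<y₁ ∷ y₁<y₂ ∷ val<val-top (after-top⇒≢top T<y₂) ∷ [-]) (1F , w-top)

    no53412 : ∀ {y₁ y₂ j₁ j₂} → T < toℕ y₁ → toℕ y₁ < toℕ y₂ → toℕ y₂ < toℕ j₁ → toℕ j₁ < toℕ j₂ →
      val j₁ < val j₂ → val j₂ < val y₁ → val y₁ < val y₂ → ⊥
    no53412 {y₁} {y₂} {j₁} {j₂} T<y₁ y₁<y₂ y₂<j₁ j₁<j₂ j₁<j₂′ j₂<y₁ y₁<y₂′ =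
      excluded φ53412 (sorts _ (3F ∷ 4F ∷ 1F ∷ 2F ∷ 0F ∷ [])) (top ∷ y₁ ∷ y₂ ∷ j₁ ∷ j₂ ∷ [])
        (T<y₁ ∷ y₁<y₂ ∷ y₂<j₁ ∷ j₁<j₂ ∷ [-])
        (j₁<j₂′ ∷ j₂<y₁ ∷ y₁<y₂′ ∷ val<val-top (after-top⇒≢top (ℕP.<-trans T<y₁ y₁<y₂)) ∷ [-]) (0F , w-top)

    largerBetween⇒noSmallerAfter : ∀ j → 1 ≤ largerBetween j → smallerAfter j ≡ 0
    largerBetween⇒noSmallerAfter j pos with count⇒witness (largerBetween? j) pos
    ... | i , T<i , i<j , j<i = count-none (smallerAfter? j) (λ l (j<l , l<j) → no4321 T<i i<j j<l l<j j<i)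

    twoLargerBefore⇒noSmallerBetween : ∀ j → 2 ≤ largerBefore j → smallerBetween j ≡ 0
    twoLargerBefore⇒noSmallerBetween j two with count⇒two-witnesses (largerBefore? j) two
    ... | a₁ , a₂ , a₁<a₂ , (a₁<T , j<a₁) , (a₂<T , j<a₂) = count-none (smallerBetween? j) none
      where
      none : ∀ c → ¬ (T < toℕ c × toℕ c < toℕ j × val c < val j)
      none c (T<c , c<j , c<j′) with val-compare a₁ a₂ (FinP.<⇒≢ a₁<a₂)
      ... | inj₁ lt = no34512 a₁<a₂ a₂<T T<c c<j c<j′ j<a₁ lt
      ... | inj₂ gt = no43512 a₁<a₂ a₂<T T<c c<j c<j′ j<a₂ gt

    largerBefore⇒smallerBetween+smallerAfter≤1 : ∀ j → T < toℕ j → 1 ≤ largerBefore j →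
      smallerBetween j + smallerAfter j ≤ 1
    largerBefore⇒smallerBetween+smallerAfter≤1 j T<j pos with count⇒witness (largerBefore? j) pos
    ... | a , a<T , j<a = +≤1 (smallerBetween j) (smallerAfter j) noTwoBetween noBoth noTwoAfter
      where
      noTwoBetween : ¬ (2 ≤ smallerBetween j)
      noTwoBetween two with count⇒two-witnesses (smallerBetween? j) two
      ... | c₁ , c₂ , c₁<c₂ , (T<c₁ , c₁<j , c₁<j′) , (_ , c₂<j , c₂<j′) with val-compare c₁ c₂ (FinP.<⇒≢ c₁<c₂)
      ... | inj₁ lt = no45123 a<T T<c₁ c₁<c₂ c₂<j lt c₂<j′ j<a
      ... | inj₂ gt = no45213 a<T T<c₁ c₁<c₂ c₂<j gt c₁<j′ j<a
      noBoth : 1 ≤ smallerBetween j → 1 ≤ smallerAfter j → ⊥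
      noBoth pos₁ pos₂ with count⇒witness (smallerBetween? j) pos₁ | count⇒witness (smallerAfter? j) pos₂
      ... | c , T<c , c<j , c<j′ | l , j<l , l<j with val-compare c l (FinP.<⇒≢ (ℕP.<-trans c<j j<l))
      ... | inj₁ lt = no45132 a<T T<c c<j j<l lt l<j j<a
      ... | inj₂ gt = no45231 a<T T<c c<j j<l gt c<j′ j<a
      noTwoAfter : ¬ (2 ≤ smallerAfter j)
      noTwoAfter two with count⇒two-witnesses (smallerAfter? j) two
      ... | l₁ , l₂ , l₁<l₂ , (j<l₁ , l₁<j) , (_ , l₂<j) with val-compare l₁ l₂ (FinP.<⇒≢ l₁<l₂)
      ... | inj₁ lt = no45312 a<T T<j j<l₁ l₁<l₂ lt l₂<j j<a
      ... | inj₂ gt = no4321 T<j j<l₁ l₁<l₂ gt l₁<j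

    crossings≡occurrences : ∀ j → crossings j ≡ largerBetween j + largerBefore j * smallerBetween j
    crossings≡occurrences j with T ℕP.<? toℕ j
    ... | yes T<j = crossings-after-top j T<j (largerBetween⇒noSmallerAfter j) (twoLargerBefore⇒noSmallerBetween j)
                      (largerBefore⇒smallerBetween+smallerAfter≤1 j T<j)
    ... | no T≮j = crossings-before-top j (ℕP.≮⇒≥ T≮j)

    before-or-after-top : ∀ {y} → val y < n → T < toℕ y ⊎ toℕ y < T
    before-or-after-top {y} y<n with ℕP.<-cmp (toℕ y) T
    ... | tri< y<T _ _ = inj₂ y<T
    ... | tri≈ _ eq _ = ⊥-elim (ℕP.<-irrefl (trans (cong val (FinP.toℕ-injective eq)) val-top) y<n)
    ... | tri> _ _ T<y = inj₁ T<y

    -- The letters counted on the left of `balance` combine with the two small letters j₁, j₂ into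
    -- a forbidden N-occurrence.
    atMostOneAfterBelow : ∀ k → T < toℕ k → ∀ j₁ j₂ → toℕ j₁ < toℕ j₂ →
      toℕ k < toℕ j₁ × val j₁ < toℕ k → toℕ k < toℕ j₂ × val j₂ < toℕ k → ⊥
    atMostOneAfterBelow k T<k j₁ j₂ j₁<j₂ (k<j₁ , j₁<k) (k<j₂ , j₂<k) =
      [ increasing , decreasing ]′ (val-compare j₁ j₂ (FinP.<⇒≢ j₁<j₂))
      where
      two : 2 ≤ ∑ (λ i → [ atOrBeforeAbove? k i ])
      two = ℕP.≤-trans (two-witnesses⇒count (afterBelow? k) (FinP.<⇒≢ j₁<j₂) (k<j₁ , j₁<k) (k<j₂ , j₂<k))
                       (ℕP.≤-reflexive (sym (balance k T<k)))
      T+1<N : suc T < suc n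
      T+1<N = s≤s (ℕP.≤-trans T<k (FinP.toℕ≤pred[n] k))
      b : Fin (suc n)
      b = Fin.fromℕ< T+1<N
      T<b : T < toℕ b
      T<b = ℕP.≤-reflexive (sym (FinP.toℕ-fromℕ< T+1<N))
      b<j₁ : toℕ b < toℕ j₁
      b<j₁ = ℕP.≤-<-trans (subst (_≤ toℕ k) (sym (FinP.toℕ-fromℕ< T+1<N)) T<k) k<j₁
      decreasing : val j₂ < val j₁ → ⊥
      decreasing j₂<j₁ with count⇒witness (atOrBeforeAbove? k) (ℕP.≤-trans (ℕP.n≤1+n 1) two)
      ... | y , y≤k , k≤y , y<n with before-or-after-top y<n
      ...   | inj₁ T<y = no4321 T<y (ℕP.≤-<-trans y≤k k<j₁) j₁<j₂ j₂<j₁ (ℕP.<-≤-trans j₁<k k≤y)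
      ...   | inj₂ y<T with val-compare j₁ b (FinP.<⇒≢ b<j₁ ∘ sym)
      ...     | inj₁ j₁<b = no4321 T<b b<j₁ j₁<j₂ j₂<j₁ j₁<b
      ...     | inj₂ b<j₁′ with val-compare j₂ b (FinP.<⇒≢ (ℕP.<-trans b<j₁ j₁<j₂) ∘ sym)
      ...       | inj₁ j₂<b = no45231 y<T T<b b<j₁ j₁<j₂ j₂<b b<j₁′ (ℕP.<-≤-trans j₁<k k≤y)
      ...       | inj₂ b<j₂ = no45132 y<T T<b b<j₁ j₁<j₂ b<j₂ j₂<j₁ (ℕP.<-≤-trans j₁<k k≤y)
      increasing : val j₁ < val j₂ → ⊥
      increasing j₁<j₂′ with count⇒two-witnesses (atOrBeforeAbove? k) two
      ... | y₁ , y₂ , y₁<y₂ , (_ , k≤y₁ , y₁<n) , (y₂≤k , k≤y₂ , y₂<n)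
        with before-or-after-top y₁<n | before-or-after-top y₂<n | val-compare y₁ y₂ (FinP.<⇒≢ y₁<y₂)
      ... | _ | inj₂ y₂<T | inj₁ lt = no34512 y₁<y₂ y₂<T (ℕP.<-trans T<k k<j₁) j₁<j₂ j₁<j₂′ (ℕP.<-≤-trans j₂<k k≤y₁) lt
      ... | _ | inj₂ y₂<T | inj₂ gt = no43512 y₁<y₂ y₂<T (ℕP.<-trans T<k k<j₁) j₁<j₂ j₁<j₂′ (ℕP.<-≤-trans j₂<k k≤y₂) gt
      ... | inj₂ y₁<T | inj₁ T<y₂ | inj₁ lt =
        no35412 y₁<T T<y₂ (ℕP.≤-<-trans y₂≤k k<j₁) j₁<j₂ j₁<j₂′ (ℕP.<-≤-trans j₂<k k≤y₁) lt
      ... | inj₂ y₁<T | inj₁ T<y₂ | inj₂ gt =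
        no45312 y₁<T T<y₂ (ℕP.≤-<-trans y₂≤k k<j₁) j₁<j₂ j₁<j₂′ (ℕP.<-≤-trans j₂<k k≤y₂) gt
      ... | inj₁ T<y₁ | _ | inj₁ lt =
        no53412 T<y₁ y₁<y₂ (ℕP.≤-<-trans y₂≤k k<j₁) j₁<j₂ j₁<j₂′ (ℕP.<-≤-trans j₂<k k≤y₁) lt
      ... | inj₁ T<y₁ | _ | inj₂ gt = no4321 T<y₁ y₁<y₂ (ℕP.≤-<-trans y₂≤k k<j₁) (ℕP.<-≤-trans j₁<k k≤y₂) gt

    inNewrep≡∑crossing : ∀ k → [ inNewrep? k ] ≡ ∑ (λ j → [ crossing? j k ])
    inNewrep≡∑crossing k = []≡ (inNewrep? k) _
      (count≤1 (λ j → crossing? j k) (λ j₁ j₂ j₁<j₂ (T<k , below₁) (_ , below₂) →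
         atMostOneAfterBelow k T<k j₁ j₂ j₁<j₂ below₁ below₂))
      (λ (T<k , j , k<j , j<k) → ℕP.≤-trans (ℕP.≤-reflexive (sym ([]-yes (crossing? j k) (T<k , k<j , j<k))))
                                            (term≤∑ (λ j → [ crossing? j k ]) j))
      (λ pos → let (j , T<k , k<j , j<k) = count⇒witness (λ j → crossing? j k) pos in T<k , j , k<j , j<k)

    ∑inNewrep≡count321-3412 : ∑ (λ k → [ inNewrep? k ]) ≡ count321-3412 w
    ∑inNewrep≡count321-3412 = begin
      ∑ (λ k → [ inNewrep? k ])
        ≡⟨ ∑-cong inNewrep≡∑crossing ⟩
      ∑ (λ k → ∑ λ j → [ crossing? j k ])
        ≡⟨ ∑-comm (λ k j → [ crossing? j k ]) ⟩
      ∑ crossings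
        ≡⟨ ∑-cong crossings≡occurrences ⟩
      ∑ (λ j → largerBetween j + largerBefore j * smallerBetween j)
        ≡⟨ ∑-+ largerBetween (λ j → largerBefore j * smallerBetween j) ⟩
      ∑ largerBetween + ∑ (λ j → largerBefore j * smallerBetween j)
        ≡⟨ cong₂ _+_ count321≡∑largerBetween count3412≡∑largerBefore*smallerBetween ⟨
      count321-3412 w ∎
      where open ≡-Reasoning

corollary4p3p1 : ∀ (n : ℕ) (w : Permutation′ (suc n)) →
    (∀ (k : ℕ) (p : Vec ℕ k) → Φ k p → AvoidsN p w) →
    Σ (List ℕ) (λ L → Unique L × (∀ k → (k ∈ L) ⇔ NewRep w k) × length L ≡ count321-3412 w)
corollary4p3p1 n w avoid with enumerate (inNewrep? w) (inNewrep-bounded w)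
... | L , unique , members , len =
  L , unique , (λ k → ⇔-trans (members k) (⇔-sym (newrep⇔inNewrep w k))) ,
  trans len (∑inNewrep≡count321-3412 w avoid)
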